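{- For every integer $n\geq 1$ there is a bijection $\Phi:\mathfrak{S}_n\rightarrow\mathfrak{L}_{n-1}$ such that whenever $\Phi(\sigma)=(w,\mu)$ with $w=w_1\cdots w_{n-1}$ and $\mu=(\mu_1,\ldots,\mu_{n-1})$, we have $$\mathrm{EXC}(\sigma)=U(w)\uplus L_1(w)\qquad\text{and}\qquad \mathrm{inv}(\sigma)-\mathrm{exc}(\sigma)=\operatorname{area}(w)+\sum_{i=1}^{n-1}\mu_i .$$
   Context: $\mathfrak{S}_n$ is the set of permutations of $[n]=\{1,\ldots,n\}$. For $\sigma\in\mathfrak{S}_n$, an index $i\in[n]$ is an excedance if $i<\sigma(i)$; $\mathrm{EXC}(\sigma)$ is the set of excedances and $\mathrm{exc}(\sigma)=|\mathrm{EXC}(\sigma)|$; $\mathrm{inv}(\sigma)=|\{(i,j): 1\le i<j\le n,\ \sigma(i)>\sigma(j)\}|$. A Motzkin path of length $m$ is a lattice path in the first quadrant from $(0,0)$ to $(m,0)$ with steps $U=(1,1)$, $L=(1,0)$, $D=(1,-1)$; a $2$-Motzkin path is a Motzkin path in which each level step is labelled $L_0$ or $L_1$, written as a word $w=w_1\cdots w_m$ over $\{U,D,L_0,L_1\}$. The height of the $i$-th step is $h_i(w)=\#\{j<i: w_j=U\}-\#\{j<i:w_j=D\}$. A Laguerre history of length $m$ is a pair $(w,\mu)$ where $w=w_1\cdots w_m$ is a $2$-Motzkin path and $\mu=(\mu_1,\ldots,\mu_m)$ is an integer vector with $0\le\mu_i\le h_i(w)$ for all $i$; $\mathfrak{L}_m$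 is the set of Laguerre histories of length $m$. For such $w$, $U(w)=\{i: w_i=U\}$, $L_1(w)=\{i: w_i=L_1\}$, and $\operatorname{area}(w)$ is the area between $w$ and the $x$-axis (equivalently $\sum_{i=1}^m h_i(w)$). $\uplus$ denotes disjoint union. -}

module Defs where

open import Data.Nat using (ℕ; zero; suc; _<?_)
open import Data.Integer using (ℤ; +_; _+_; _-_; _≤_; 0ℤ; 1ℤ; -1ℤ)
open import Data.Fin using (Fin; toℕ)
open import Data.Fin.Permutation using (Permutation′; _⟨$⟩ʳ_)
open import Data.List using (List; []; _∷_; take; map; allFin; foldr)
open import Data.Nat.ListAction using (sum)
open import Data.Vec using (Vec; toList; lookup)
open import Data.Bool using (Bool; true; false; if_then_else_; _∧_)
open import Relation.Nullary using (does)
open import Relation.Binary.PropositionalEquality using (_≡_)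
open import Data.Product using (_×_)

-- Permutation statistics (positions are Fin n, i.e. 0-based: the paper's
-- index i ∈ [n] corresponds to i - 1 : Fin n; the relation i < σ(i)
-- is invariant under this shift).

[_] : Bool → ℕ
[ b ] = if b then 1 else 0

isExc : ∀ {n} → Permutation′ n → Fin n → Bool
isExc σ i = does (toℕ i <? toℕ (σ ⟨$⟩ʳ i))

exc : ∀ {n} → Permutation′ n → ℕ
exc {n} σ = sum (map (λ i → [ isExc σ i ]) (allFin n))

inv : ∀ {n} → Permutation′ n → ℕ
inv {n} σ = sum (map (λ i → sum (map (λ j →
  [ does (toℕ i <? toℕ j) ∧ does (toℕ (σ ⟨$⟩ʳ j) <? toℕ (σ ⟨$⟩ʳ i)) ])
  (allFin n))) (allFin n))

data Step : Set where
  U D L₀ L₁ : Step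

stepHeight : Step → ℤ
stepHeight U  = 1ℤ
stepHeight D  = -1ℤ
stepHeight L₀ = 0ℤ
stepHeight L₁ = 0ℤ

netHeight : List Step → ℤ
netHeight []       = 0ℤ
netHeight (s ∷ ss) = stepHeight s + netHeight ss

-- height h_i(w) of the step at (0-based) position i: #U - #D strictly before it
height : ∀ {m} → Vec Step m → Fin m → ℤ
height w i = netHeight (take (toℕ i) (toList w))

IsMotzkin : ∀ {m} → Vec Step m → Set
IsMotzkin {m} w = (∀ (k : Fin (suc m)) → 0ℤ ≤ netHeight (take (toℕ k) (toList w)))
                  × netHeight (toList w) ≡ 0ℤ

record Laguerre (m : ℕ) : Set where
  constructor laguerre
  field
    path    : Vec Step m
    weights : Vec ℕ m
    motzkin : IsMotzkin path
    bounded : ∀ (i : Fin m) → + lookup weights i ≤ height path i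

isUorL₁ : Step → Bool
isUorL₁ U  = true
isUorL₁ D  = false
isUorL₁ L₀ = false
isUorL₁ L₁ = true

area : ∀ {m} → Vec Step m → ℤ
area {m} w = foldr _+_ 0ℤ (map (height w) (allFin m))

sumℕ : ∀ {m} → Vec ℕ m → ℕ
sumℕ v = sum (toList v)

-- Encoding: step i records whether i is an excedance and whether the value i + 1 sits at
-- a non-excedance; the height before step i is the number cross i of arcs j ↦ σ j over
-- the gap i (cross-formula), so w is a Motzkin path with area ∑ cross; the weight μ i
-- counts earlier larger values at an excedance and later smaller values otherwise, so
-- μ i ≤ cross i and inv = exc + area + ∑ μ (inversion-decomposition).
-- Decoding rebuilds σ by choosing values by rank (Selection): non-excedances left to
-- right, excedances right to left.
module Submission where

module FiniteSums where

  open import Defs using ([_])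
  open import Data.Nat using (ℕ; zero; suc; _+_; _∸_; _≤_; _<_; z≤n; s≤s; _<ᵇ_; _≡ᵇ_; _⊓_)
  open import Data.Nat.Properties
  open import Data.Bool using (Bool; true; false; if_then_else_; _∧_; _∨_)
  open import Data.Fin using (Fin; toℕ) renaming (zero to fz; suc to fs)
  open import Data.List using (map; allFin; tabulate)
  open import Data.List.Properties using (map-tabulate)
  open import Data.Nat.ListAction using (sum)
  open import Relation.Nullary using (¬_)
  open import Data.Sum using (inj₁; inj₂)
  open import Relation.Nullary.Negation using (contradiction)
  open import Relation.Nullary.Reflects using (Reflects; ofʸ; ofⁿ; fromEquivalence)
  open import Relation.Binary.PropositionalEquality hiding ([_])
  open import Relation.Binary using (tri<; tri≈; tri>)
  open import Algebra.Properties.CommutativeSemigroup +-commutativeSemigroup using (interchange)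
  open import Function using (_∘_)

  ≡ᵇ-reflects : ∀ a b → Reflects (a ≡ b) (a ≡ᵇ b)
  ≡ᵇ-reflects a b = fromEquivalence (≡ᵇ⇒≡ a b) (≡⇒≡ᵇ a b)

  reflects-ext : ∀ {P Q : Set} (a b : Bool) → Reflects P a → Reflects Q b → (P → Q) → (Q → P) → a ≡ b
  reflects-ext true true _ _ _ _ = refl
  reflects-ext true false (ofʸ p) (ofⁿ ¬q) pq qp = contradiction (pq p) ¬q
  reflects-ext false true (ofⁿ ¬p) (ofʸ q) pq qp = contradiction (qp q) ¬p
  reflects-ext false false _ _ _ _ = refl

  <ᵇ-true : ∀ {x y} → x < y → (x <ᵇ y) ≡ true
  <ᵇ-true {x} {y} x<y with x <ᵇ y | <ᵇ-reflects-< x y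
  ... | true | _ = refl
  ... | false | ofⁿ ¬q = contradiction x<y ¬q

  <ᵇ-false : ∀ {x y} → ¬ x < y → (x <ᵇ y) ≡ false
  <ᵇ-false {x} {y} ¬x<y with x <ᵇ y | <ᵇ-reflects-< x y
  ... | true | ofʸ q = contradiction q ¬x<y
  ... | false | _ = refl

  n<ᵇn : ∀ k → (k <ᵇ k) ≡ false
  n<ᵇn k = <ᵇ-false (n≮n k)

  n<ᵇ1+n : ∀ k → (k <ᵇ suc k) ≡ true
  n<ᵇ1+n k = <ᵇ-true (n<1+n k)

  ≡ᵇ-self : ∀ k → (k ≡ᵇ k) ≡ true
  ≡ᵇ-self zero = refl
  ≡ᵇ-self (suc k) = ≡ᵇ-self k

  -- Shifting a comparison by t, used to index positions from the right end.
  <ᵇ-∸ : ∀ m t x → t ≤ m → (m <ᵇ x + t) ≡ ((m ∸ t) <ᵇ x)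
  <ᵇ-∸ m t x t≤m = reflects-ext _ _ (<ᵇ-reflects-< m (x + t)) (<ᵇ-reflects-< (m ∸ t) x)
    (λ lt → +-cancelʳ-< t (m ∸ t) x (subst (_< x + t) (sym (m∸n+n≡m t≤m)) lt))
    (λ lt → subst (_< x + t) (m∸n+n≡m t≤m) (+-monoˡ-< t lt))

  ≡ᵇ-∸ : ∀ m t x → t ≤ m → (m ≡ᵇ x + t) ≡ (x ≡ᵇ m ∸ t)
  ≡ᵇ-∸ m t x t≤m = reflects-ext _ _ (≡ᵇ-reflects m (x + t)) (≡ᵇ-reflects x (m ∸ t))
    (λ e → sym (trans (cong (_∸ t) e) (m+n∸n≡m x t)))
    (λ e → trans (sym (m∸n+n≡m t≤m)) (cong (_+ t) (sym e)))

  <ᵇ-suc : ∀ x y → (x <ᵇ suc y) ≡ (x <ᵇ y) ∨ (x ≡ᵇ y)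
  <ᵇ-suc x y with x <ᵇ y | <ᵇ-reflects-< x y | x ≡ᵇ y | ≡ᵇ-reflects x y | x <ᵇ suc y | <ᵇ-reflects-< x (suc y)
  ... | true | ofʸ p | _ | _ | true | _ = refl
  ... | true | ofʸ p | _ | _ | false | ofⁿ q = contradiction (m<n⇒m<1+n p) q
  ... | false | _ | true | _ | true | _ = refl
  ... | false | _ | true | ofʸ refl | false | ofⁿ q = contradiction (n<1+n x) q
  ... | false | _ | false | _ | false | _ = refl
  ... | false | ofⁿ p | false | ofⁿ q | true | ofʸ r with m≤n⇒m<n∨m≡n (≤-pred r)
  ...   | inj₁ lt = contradiction lt p
  ...   | inj₂ eq = contradiction eq q

  infixr 7 _?·_
  _?·_ : Bool → ℕ → ℕ
  b ?· x = if b then x else 0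

  [∧] : ∀ x y → [ x ∧ y ] ≡ x ?· [ y ]
  [∧] true y = refl
  [∧] false y = refl

  ?·-swap : ∀ x y → x ?· [ y ] ≡ y ?· [ x ]
  ?·-swap true true = refl
  ?·-swap true false = refl
  ?·-swap false true = refl
  ?·-swap false false = refl

  [<]+[>]≡1 : ∀ x k → x ≢ k → [ x <ᵇ k ] + [ k <ᵇ x ] ≡ 1
  [<]+[>]≡1 x k ne with x <ᵇ k | <ᵇ-reflects-< x k | k <ᵇ x | <ᵇ-reflects-< k x
  ... | true | ofʸ p | true | ofʸ q = contradiction (<-trans p q) (n≮n x)
  ... | true | _ | false | _ = refl
  ... | false | _ | true | _ = refl
  ... | false | ofⁿ p | false | ofⁿ q with <-cmp x k
  ... | tri< a _ _ = contradiction a p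
  ... | tri≈ _ e _ = contradiction e ne
  ... | tri> _ _ c = contradiction c q

  [<]+[>]+[≡]≡1 : ∀ x i → [ x <ᵇ i ] + [ i <ᵇ x ] + [ x ≡ᵇ i ] ≡ 1
  [<]+[>]+[≡]≡1 x i with x ≡ᵇ i | ≡ᵇ-reflects x i
  ... | true | ofʸ refl rewrite n<ᵇn x = refl
  ... | false | ofⁿ ne = trans (+-identityʳ _) ([<]+[>]≡1 x i ne)

  [<]-split-suc : ∀ k x → [ k <ᵇ x ] ≡ [ suc k <ᵇ x ] + [ x ≡ᵇ suc k ]
  [<]-split-suc k x with k <ᵇ x | <ᵇ-reflects-< k x | suc k <ᵇ x | <ᵇ-reflects-< (suc k) x | x ≡ᵇ suc k | ≡ᵇ-reflects x (suc k)
  ... | true | _ | true | ofʸ q | true | ofʸ e = contradiction (subst (suc k <_) e q) (n≮n (suc k))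
  ... | true | _ | true | _ | false | _ = refl
  ... | true | _ | false | _ | true | _ = refl
  ... | true | ofʸ p | false | ofⁿ q | false | ofⁿ r with m≤n⇒m<n∨m≡n p
  ...   | inj₁ lt = contradiction lt q
  ...   | inj₂ eq = contradiction (sym eq) r
  [<]-split-suc k x | false | ofⁿ p | true | ofʸ q | _ | _ = contradiction (<-trans (n<1+n k) q) p
  [<]-split-suc k x | false | ofⁿ p | false | _ | true | ofʸ e = contradiction (subst (k <_) (sym e) (n<1+n k)) p
  [<]-split-suc k x | false | _ | false | _ | false | _ = refl

  [<]-skip-suc : ∀ k y → y ≢ suc k → [ k <ᵇ y ] ≡ [ suc k <ᵇ y ]
  [<]-skip-suc k y ne = trans ([<]-split-suc k y) (trans (cong ([ suc k <ᵇ y ] +_) (not-equal (y ≡ᵇ suc k) (≡ᵇ-reflects y (suc k)))) (+-identityʳ _))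
    where
    not-equal : ∀ b → Reflects (y ≡ suc k) b → [ b ] ≡ 0
    not-equal true (ofʸ e) = contradiction e ne
    not-equal false _ = refl

  ∑ : ℕ → (ℕ → ℕ) → ℕ
  ∑ zero f = 0
  ∑ (suc n) f = ∑ n f + f n

  ∑-cong : ∀ n {f g : ℕ → ℕ} → (∀ j → j < n → f j ≡ g j) → ∑ n f ≡ ∑ n g
  ∑-cong zero h = refl
  ∑-cong (suc n) h = cong₂ _+_ (∑-cong n (λ j j<n → h j (m<n⇒m<1+n j<n))) (h n ≤-refl)

  ∑-+ : ∀ n (f g : ℕ → ℕ) → ∑ n (λ j → f j + g j) ≡ ∑ n f + ∑ n g
  ∑-+ zero f g = refl
  ∑-+ (suc n) f g rewrite ∑-+ n f g = interchange (∑ n f) (∑ n g) (f n) (g n)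

  ∑-mono : ∀ n {f g : ℕ → ℕ} → (∀ j → j < n → f j ≤ g j) → ∑ n f ≤ ∑ n g
  ∑-mono zero h = z≤n
  ∑-mono (suc n) h = +-mono-≤ (∑-mono n (λ j j<n → h j (m<n⇒m<1+n j<n))) (h n ≤-refl)

  ∑-zero : ∀ n {f : ℕ → ℕ} → (∀ j → j < n → f j ≡ 0) → ∑ n f ≡ 0
  ∑-zero zero h = refl
  ∑-zero (suc n) h rewrite ∑-zero n (λ j j<n → h j (m<n⇒m<1+n j<n)) = h n ≤-refl

  ∑-one : ∀ n → ∑ n (λ _ → 1) ≡ n
  ∑-one zero = refl
  ∑-one (suc n) rewrite ∑-one n = +-comm n 1

  ∑-mono-range : ∀ (h : ℕ → ℕ) {a b} → a ≤ b → ∑ a h ≤ ∑ b h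
  ∑-mono-range h {a} {b} a≤b = subst (λ c → ∑ a h ≤ ∑ c h) (m∸n+n≡m a≤b) (extend (b ∸ a))
    where
    extend : ∀ d → ∑ a h ≤ ∑ (d + a) h
    extend zero = ≤-refl
    extend (suc d) = ≤-trans (extend d) (m≤m+n (∑ (d + a) h) (h (d + a)))

  ∑-unfoldˡ : ∀ n (f : ℕ → ℕ) → ∑ (suc n) f ≡ f 0 + ∑ n (f ∘ suc)
  ∑-unfoldˡ zero f = +-comm 0 (f 0)
  ∑-unfoldˡ (suc n) f rewrite ∑-unfoldˡ n f = +-assoc (f 0) (∑ n (f ∘ suc)) (f (suc n))

  ∑-swap : ∀ n k (F : ℕ → ℕ → ℕ) → ∑ n (λ i → ∑ k (F i)) ≡ ∑ k (λ j → ∑ n (λ i → F i j))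
  ∑-swap zero k F = sym (∑-zero k (λ _ _ → refl))
  ∑-swap (suc n) k F rewrite ∑-swap n k F = sym (∑-+ k (λ j → ∑ n (λ i → F i j)) (F n))

  ∑-restrict : ∀ n i (h : ℕ → ℕ) → ∑ n (λ b → (b <ᵇ i) ?· h b) ≡ ∑ (n ⊓ i) h
  ∑-restrict zero i h = refl
  ∑-restrict (suc n) i h with n <ᵇ i | <ᵇ-reflects-< n i
  ... | true | ofʸ n<i rewrite ∑-restrict n i h | m≤n⇒m⊓n≡m (<⇒≤ n<i) | m≤n⇒m⊓n≡m n<i = refl
  ... | false | ofⁿ n≮i rewrite ∑-restrict n i h | m≥n⇒m⊓n≡n (≮⇒≥ n≮i) | m≥n⇒m⊓n≡n (m≤n⇒m≤1+n (≮⇒≥ n≮i)) = +-identityʳ _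

  ∑-restrict′ : ∀ n i (h : ℕ → ℕ) → i ≤ n → ∑ n (λ b → (b <ᵇ i) ?· h b) ≡ ∑ i h
  ∑-restrict′ n i h i≤n = trans (∑-restrict n i h) (cong (λ k → ∑ k h) (m≥n⇒m⊓n≡n i≤n))

  ∑-count< : ∀ n k → k ≤ n → ∑ n (λ j → [ j <ᵇ k ]) ≡ k
  ∑-count< n k k≤n = trans (∑-restrict′ n k (λ _ → 1) k≤n) (∑-one k)

  ∑-single : ∀ n i (h : ℕ → ℕ) → ∑ n (λ b → (b ≡ᵇ i) ?· h b) ≡ (i <ᵇ n) ?· h i
  ∑-single zero i h = refl
  ∑-single (suc n) i h rewrite ∑-single n i h with n ≡ᵇ i | ≡ᵇ-reflects n i | i <ᵇ n | <ᵇ-reflects-< i n | i <ᵇ suc n | <ᵇ-reflects-< i (suc n)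
  ... | true | ofʸ refl | _ | ofʸ p | _ | _ = contradiction p (n≮n n)
  ... | true | ofʸ refl | _ | ofⁿ _ | _ | ofʸ _ = refl
  ... | true | ofʸ refl | _ | ofⁿ _ | _ | ofⁿ q = contradiction (n<1+n n) q
  ... | false | ofⁿ _ | _ | ofʸ _ | _ | ofʸ _ = +-identityʳ _
  ... | false | ofⁿ _ | _ | ofʸ p | _ | ofⁿ q = contradiction (m<n⇒m<1+n p) q
  ... | false | ofⁿ _ | _ | ofⁿ _ | _ | ofⁿ _ = refl
  ... | false | ofⁿ ne | _ | ofⁿ p | _ | ofʸ q = contradiction (≤∧≢⇒< (≤-pred q) (λ e → ne (sym e))) p

  ∑-single′ : ∀ n i (h : ℕ → ℕ) → i < n → ∑ n (λ b → (b ≡ᵇ i) ?· h b) ≡ h i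
  ∑-single′ n i h i<n = trans (∑-single n i h) (cong (_?· h i) (<ᵇ-true i<n))

  ∑-point : ∀ n k → k < n → ∑ n (λ u → [ k ≡ᵇ u ]) ≡ 1
  ∑-point n k k<n = trans (∑-cong n (λ u _ → cong [_] (≡ᵇ-comm k u))) (∑-single′ n k (λ _ → 1) k<n)
    where
    ≡ᵇ-comm : ∀ a b → (a ≡ᵇ b) ≡ (b ≡ᵇ a)
    ≡ᵇ-comm a b = reflects-ext _ _ (≡ᵇ-reflects a b) (≡ᵇ-reflects b a) sym sym

  trichotomy-split : ∀ i b (x : ℕ) → x ≡ (b <ᵇ i) ?· x + (b ≡ᵇ i) ?· x + (i <ᵇ b) ?· x
  trichotomy-split i b x with b <ᵇ i | <ᵇ-reflects-< b i | b ≡ᵇ i | ≡ᵇ-reflects b i | i <ᵇ b | <ᵇ-reflects-< i b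
  ... | true | ofʸ p | true | ofʸ refl | _ | _ = contradiction p (n≮n b)
  ... | true | ofʸ p | false | _ | true | ofʸ q = contradiction (<-trans p q) (n≮n b)
  ... | true | ofʸ p | false | _ | false | _ = sym (trans (+-identityʳ _) (+-identityʳ _))
  ... | false | _ | true | ofʸ refl | true | ofʸ q = contradiction q (n≮n b)
  ... | false | _ | true | ofʸ refl | false | _ = sym (+-identityʳ _)
  ... | false | _ | false | _ | true | _ = refl
  ... | false | ofⁿ p | false | ofⁿ q | false | ofⁿ r with <-cmp b i
  ... | tri< a _ _ = contradiction a p
  ... | tri≈ _ e _ = contradiction e q
  ... | tri> _ _ c = contradiction c r

  ∑-split : ∀ n i (h : ℕ → ℕ) → i < n → ∑ n h ≡ ∑ i h + h i + ∑ n (λ b → (i <ᵇ b) ?· h b)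
  ∑-split n i h i<n = begin
    ∑ n h
      ≡⟨ ∑-cong n (λ b _ → trichotomy-split i b (h b)) ⟩
    ∑ n (λ b → (b <ᵇ i) ?· h b + (b ≡ᵇ i) ?· h b + (i <ᵇ b) ?· h b)
      ≡⟨ trans (∑-+ n _ _) (cong (_+ ∑ n (λ b → (i <ᵇ b) ?· h b)) (∑-+ n _ _)) ⟩
    ∑ n (λ b → (b <ᵇ i) ?· h b) + ∑ n (λ b → (b ≡ᵇ i) ?· h b) + ∑ n (λ b → (i <ᵇ b) ?· h b)
      ≡⟨ cong₂ (λ x y → x + y + ∑ n (λ b → (i <ᵇ b) ?· h b)) (∑-restrict′ n i h (<⇒≤ i<n)) (∑-single′ n i h i<n) ⟩
    ∑ i h + h i + ∑ n (λ b → (i <ᵇ b) ?· h b) ∎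
    where open ≡-Reasoning

  ∑> : ℕ → ℕ → (ℕ → ℕ) → ℕ
  ∑> n q h = ∑ n (λ i → (q <ᵇ i) ?· h i)

  ∑≥ : ℕ → ℕ → (ℕ → ℕ) → ℕ
  ∑≥ n q h = ∑ n (λ i → (q <ᵇ suc i) ?· h i)

  ∑-prefix-suffix : ∀ n q h → q ≤ n → ∑ n h ≡ ∑ q h + ∑≥ n q h
  ∑-prefix-suffix n q h q≤n = trans (∑-cong n (λ i _ → below-or-from i)) (trans (∑-+ n _ _) (cong (_+ ∑≥ n q h) (∑-restrict′ n q h q≤n)))
    where
    below-or-from : ∀ i → h i ≡ (i <ᵇ q) ?· h i + (q <ᵇ suc i) ?· h i
    below-or-from i with i <ᵇ q | <ᵇ-reflects-< i q | q <ᵇ suc i | <ᵇ-reflects-< q (suc i)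
    ... | true | ofʸ a | true | ofʸ b = contradiction (<-≤-trans a (≤-pred b)) (n≮n i)
    ... | true | _ | false | _ = sym (+-identityʳ _)
    ... | false | _ | true | _ = refl
    ... | false | ofⁿ a | false | ofⁿ b = contradiction (s≤s (≮⇒≥ a)) b

  ∑≥-unfold : ∀ n q h → q < n → ∑≥ n q h ≡ ∑> n q h + h q
  ∑≥-unfold n q h q<n = trans (∑-cong n (λ i _ → above-or-at i)) (trans (∑-+ n _ _) (cong (∑> n q h +_) (∑-single′ n q h q<n)))
    where
    above-or-at : ∀ i → (q <ᵇ suc i) ?· h i ≡ (q <ᵇ i) ?· h i + (i ≡ᵇ q) ?· h i
    above-or-at i rewrite <ᵇ-suc q i with q <ᵇ i | <ᵇ-reflects-< q i | i ≡ᵇ q | ≡ᵇ-reflects i q | q ≡ᵇ i | ≡ᵇ-reflects q i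
    ... | true | ofʸ a | true | ofʸ refl | _ | _ = contradiction a (n≮n q)
    ... | true | _ | false | _ | _ | _ = sym (+-identityʳ _)
    ... | false | _ | true | ofʸ refl | true | _ = refl
    ... | false | _ | true | ofʸ refl | false | ofⁿ ne = contradiction refl ne
    ... | false | _ | false | ofⁿ ne | true | ofʸ e = contradiction (sym e) ne
    ... | false | _ | false | _ | false | _ = refl

  ∑>-unfold : ∀ n q h → ∑> n q h ≡ ∑> n (suc q) h + (suc q <ᵇ n) ?· h (suc q)
  ∑>-unfold n q h = trans (∑-cong n (λ i _ → above-or-next i)) (trans (∑-+ n _ _) (cong (∑> n (suc q) h +_) (∑-single n (suc q) h)))
    where
    above-or-next : ∀ i → (q <ᵇ i) ?· h i ≡ (suc q <ᵇ i) ?· h i + (i ≡ᵇ suc q) ?· h i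
    above-or-next i with q <ᵇ i | <ᵇ-reflects-< q i | suc q <ᵇ i | <ᵇ-reflects-< (suc q) i | i ≡ᵇ suc q | ≡ᵇ-reflects i (suc q)
    ... | _ | _ | true | ofʸ a | true | ofʸ refl = contradiction a (n≮n i)
    ... | true | _ | true | _ | false | _ = sym (+-identityʳ _)
    ... | true | _ | false | _ | true | _ = refl
    ... | true | ofʸ a | false | ofⁿ b | false | ofⁿ c with m≤n⇒m<n∨m≡n a
    ...   | inj₁ lt = contradiction lt b
    ...   | inj₂ e = contradiction (sym e) c
    above-or-next i | false | ofⁿ a | true | ofʸ b | _ | _ = contradiction (<-trans (n<1+n q) b) a
    above-or-next i | false | ofⁿ a | false | _ | true | ofʸ refl = contradiction (n<1+n q) a
    above-or-next i | false | _ | false | _ | false | _ = refl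

  [∨]-disjoint : ∀ a b → (a ≡ true → b ≡ false) → [ a ∨ b ] ≡ [ a ] + [ b ]
  [∨]-disjoint true b h rewrite h refl = refl
  [∨]-disjoint false b h = refl

  ∑-insert : ∀ n (A : ℕ → Bool) k → k < n → A k ≡ false → ∑ n (λ u → [ A u ∨ (k ≡ᵇ u) ]) ≡ ∑ n ([_] ∘ A) + 1
  ∑-insert n A k k<n Ak = trans (∑-cong n (λ u _ → [∨]-disjoint (A u) (k ≡ᵇ u) (k-new u)))
    (trans (∑-+ n _ _) (cong (∑ n ([_] ∘ A) +_) (∑-point n k k<n)))
    where
    k-new : ∀ u → A u ≡ true → (k ≡ᵇ u) ≡ false
    k-new u e with k ≡ᵇ u | ≡ᵇ-reflects k u
    ... | false | _ = refl
    ... | true | ofʸ refl = contradiction (trans (sym Ak) e) λ ()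

  sum-tabulate≡∑ : ∀ n (h : Fin n → ℕ) (h' : ℕ → ℕ) → (∀ i → h i ≡ h' (toℕ i)) → sum (tabulate h) ≡ ∑ n h'
  sum-tabulate≡∑ zero h h' e = refl
  sum-tabulate≡∑ (suc n) h h' e =
    trans (cong₂ _+_ (e fz) (sum-tabulate≡∑ n (h ∘ fs) (h' ∘ suc) (λ i → e (fs i)))) (sym (∑-unfoldˡ n h'))

  sum-allFin≡∑ : ∀ n (h : Fin n → ℕ) (h' : ℕ → ℕ) → (∀ i → h i ≡ h' (toℕ i)) → sum (map h (allFin n)) ≡ ∑ n h'
  sum-allFin≡∑ n h h' e = trans (cong sum (map-tabulate (λ x → x) h)) (sum-tabulate≡∑ n h h' e)


-- Permutations of [0, n) as a pair of mutually inverse functions on ℕ, so that the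
-- sums ∑ of FiniteSums can be reindexed along them.
module NatPermutations where

  open FiniteSums
  open import Data.Nat using (ℕ; zero; suc; _+_; _<_; _<?_)
  open import Data.Fin using (Fin; toℕ; fromℕ<)
  open import Data.Fin.Properties using (toℕ<n; toℕ-fromℕ<; fromℕ<-toℕ)
  open import Data.Fin.Permutation using (Permutation′; _⟨$⟩ʳ_; _⟨$⟩ˡ_; inverseˡ; inverseʳ)
  open import Relation.Nullary using (yes; no)
  open import Relation.Nullary.Negation using (contradiction)
  open import Relation.Binary.PropositionalEquality
  open import Function using (_∘_)
  open import Data.Nat.Properties using (+-0-commutativeMonoid)
  import Algebra.Properties.CommutativeMonoid.Sum +-0-commutativeMonoid as FinSum

  record PermN (n : ℕ) : Set where
    field
      f g : ℕ → ℕ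
      f< : ∀ j → j < n → f j < n
      g< : ∀ j → j < n → g j < n
      gf : ∀ j → j < n → g (f j) ≡ j
      fg : ∀ j → j < n → f (g j) ≡ j
      ∑-reindex : ∀ (h : ℕ → ℕ) → ∑ n h ≡ ∑ n (h ∘ f)

  ext : ∀ {n} → (Fin n → Fin n) → ℕ → ℕ
  ext {n} φ j with j <? n
  ... | yes p = toℕ (φ (fromℕ< p))
  ... | no _ = 0

  ext-toℕ : ∀ {n} (φ : Fin n → Fin n) (i : Fin n) → ext φ (toℕ i) ≡ toℕ (φ i)
  ext-toℕ {n} φ i with toℕ i <? n
  ... | yes p = cong (toℕ ∘ φ) (fromℕ<-toℕ i p)
  ... | no ¬p = contradiction (toℕ<n i) ¬p

  ext-fromℕ< : ∀ {n} (φ : Fin n → Fin n) j (p : j < n) → ext φ j ≡ toℕ (φ (fromℕ< p))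
  ext-fromℕ< φ j p = trans (cong (ext φ) (sym (toℕ-fromℕ< p))) (ext-toℕ φ (fromℕ< p))

  sum-Fin≡∑ : ∀ n (h : ℕ → ℕ) → FinSum.sum {n} (λ i → h (toℕ i)) ≡ ∑ n h
  sum-Fin≡∑ zero h = refl
  sum-Fin≡∑ (suc n) h = trans (cong (h 0 +_) (sum-Fin≡∑ n (h ∘ suc))) (sym (∑-unfoldˡ n h))

  toPermN : ∀ {n} → Permutation′ n → PermN n
  toPermN {n} π = record
    { f = F ; g = G
    ; f< = λ j p → subst (_< n) (sym (ext-fromℕ< (π ⟨$⟩ʳ_) j p)) (toℕ<n _)
    ; g< = λ j p → subst (_< n) (sym (ext-fromℕ< (π ⟨$⟩ˡ_) j p)) (toℕ<n _)
    ; gf = λ j p → trans (cong G (ext-fromℕ< (π ⟨$⟩ʳ_) j p))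
                    (trans (ext-toℕ (π ⟨$⟩ˡ_) _) (trans (cong toℕ (inverseˡ π)) (toℕ-fromℕ< p)))
    ; fg = λ j p → trans (cong F (ext-fromℕ< (π ⟨$⟩ˡ_) j p))
                    (trans (ext-toℕ (π ⟨$⟩ʳ_) _) (trans (cong toℕ (inverseʳ π)) (toℕ-fromℕ< p)))
    ; ∑-reindex = λ h → trans (sym (sum-Fin≡∑ n h))
                     (trans (FinSum.sum-permute (λ i → h (toℕ i)) π)
                     (trans (FinSum.sum-cong-≗ (λ i → cong h (sym (ext-toℕ (π ⟨$⟩ʳ_) i))))
                       (sum-Fin≡∑ n (h ∘ F))))
    }
    where
    F = ext (π ⟨$⟩ʳ_)
    G = ext (π ⟨$⟩ˡ_)


module Encoding where

  open FiniteSums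
  open NatPermutations
  open import Defs using (Step; U; D; L₀; L₁; [_])
  open import Data.Nat using (ℕ; zero; suc; _+_; _≤_; _<_; z≤n; s≤s; s<s; _<ᵇ_; _≡ᵇ_)
  open import Data.Nat.Properties
  open import Data.Bool using (Bool; true; false; if_then_else_; _∧_; not)
  open import Relation.Nullary.Negation using (contradiction)
  open import Relation.Nullary.Reflects using (ofʸ; ofⁿ; ¬-reflects)
  open import Relation.Binary.PropositionalEquality hiding ([_])
  open import Function using (_∘_)
  open import Data.Nat.Tactic.RingSolver using (solve-∀)
  open import Algebra.Properties.CommutativeSemigroup +-commutativeSemigroup using (interchange)
  open import Data.Sum using (inj₁; inj₂)
  open import Data.Product using (_×_; _,_)
  open import Relation.Binary using (tri<; tri≈; tri>)

  -- The step with excedance bit a (U, L₁) and weak bit b (U, L₀).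
  mkStep : Bool → Bool → Step
  mkStep true true = U
  mkStep true false = L₁
  mkStep false true = L₀
  mkStep false false = D

  module Code {m : ℕ} (P : PermN (suc m)) where
    open PermN P

    n : ℕ
    n = suc m

    excᵇ : ℕ → Bool
    excᵇ j = j <ᵇ f j

    -- The value i + 1 is a weak value, i.e. taken at a non-excedance: i < σ⁻¹ (i + 1).
    weakᵇ : ℕ → Bool
    weakᵇ i = i <ᵇ g (suc i)

    weakᵇ≡ : ∀ i → weakᵇ i ≡ not (g (suc i) <ᵇ suc i)
    weakᵇ≡ i = reflects-ext _ _ (<ᵇ-reflects-< i (g (suc i))) (¬-reflects (<ᵇ-reflects-< (g (suc i)) (suc i)))
      (λ lt ge → <⇒≱ ge lt) (λ ¬ge → ≤-pred (≰⇒> ¬ge))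

    step : ℕ → Step
    step i = mkStep (excᵇ i) (weakᵇ i)

    μ : ℕ → ℕ
    μ i = if excᵇ i then ∑ i (λ b → [ f i <ᵇ f b ]) else ∑ n (λ b → (i <ᵇ b) ?· [ f b <ᵇ f i ])

    μ-nonexc : ∀ p → excᵇ p ≡ false → μ p ≡ ∑ n (λ b → (p <ᵇ b) ?· [ f b <ᵇ f p ])
    μ-nonexc p e = cong (λ c → if c then ∑ p (λ b → [ f p <ᵇ f b ]) else ∑ n (λ b → (p <ᵇ b) ?· [ f b <ᵇ f p ])) e

    μ-exc : ∀ p → excᵇ p ≡ true → μ p ≡ ∑ p (λ b → [ f p <ᵇ f b ])
    μ-exc p e = cong (λ c → if c then ∑ p (λ b → [ f p <ᵇ f b ]) else ∑ n (λ b → (p <ᵇ b) ?· [ f b <ᵇ f p ])) e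

    excᵇ-false : ∀ {p} → excᵇ p ≡ false → f p ≤ p
    excᵇ-false {p} e = ≮⇒≥ (λ p<fp → contradiction (trans (sym (<ᵇ-true p<fp)) e) λ ())

    excᵇ-true : ∀ {p} → excᵇ p ≡ true → p < f p
    excᵇ-true {p} e with excᵇ p | <ᵇ-reflects-< p (f p)
    excᵇ-true {p} refl | true | ofʸ q = q

    -- The number of arcs j ↦ σ j with j < k < σ j; it will be the height before step k.
    cross : ℕ → ℕ
    cross k = ∑ k (λ j → [ k <ᵇ f j ])

    f-inj : ∀ {a b} → a < n → b < n → f a ≡ f b → a ≡ b
    f-inj {a} {b} a< b< e = trans (sym (gf a a<)) (trans (cong g e) (gf b b<))

    count-values< : ∀ c → c ≤ n → ∑ n (λ b → [ f b <ᵇ c ]) ≡ c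
    count-values< c c≤n = trans (sym (∑-reindex (λ v → [ v <ᵇ c ]))) (∑-count< n c c≤n)

    count-value≡ : ∀ v k → v < n → k ≤ n → ∑ k (λ b → [ f b ≡ᵇ v ]) ≡ [ g v <ᵇ k ]
    count-value≡ v zero v< k≤ = refl
    count-value≡ v (suc k) v< k≤ rewrite count-value≡ v k v< (≤-trans (n≤1+n k) k≤)
      with f k ≡ᵇ v | ≡ᵇ-reflects (f k) v | g v <ᵇ k | <ᵇ-reflects-< (g v) k | g v <ᵇ suc k | <ᵇ-reflects-< (g v) (suc k)
    ... | true | ofʸ e | _ | ofʸ p | _ | _ = contradiction (subst (_< k) (trans (cong g (sym e)) (gf k k≤)) p) (n≮n k)
    ... | true | ofʸ e | _ | ofⁿ _ | _ | ofʸ _ = refl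
    ... | true | ofʸ e | _ | ofⁿ _ | _ | ofⁿ q = contradiction (subst (_< suc k) (sym (trans (cong g (sym e)) (gf k k≤))) (n<1+n k)) q
    ... | false | _ | _ | ofʸ p | _ | ofʸ _ = refl
    ... | false | _ | _ | ofʸ p | _ | ofⁿ q = contradiction (m<n⇒m<1+n p) q
    ... | false | _ | _ | ofⁿ _ | _ | ofⁿ _ = refl
    ... | false | ofⁿ ne | _ | ofⁿ p | _ | ofʸ q with m≤n⇒m<n∨m≡n (≤-pred q)
    ...   | inj₁ lt = contradiction lt p
    ...   | inj₂ eq = contradiction (trans (cong f (sym eq)) (fg v v<)) ne

    -- The height recursion: h (k + 1) = h k + [k is an excedance] + [k + 1 is a weak value] - 1.
    cross-step : ∀ k → k < m → cross k + [ excᵇ k ] + [ weakᵇ k ] ≡ 1 + cross (suc k)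
    cross-step k k<m = begin
        cross k + [ excᵇ k ] + [ weakᵇ k ]
          ≡⟨ cong (λ z → z + [ excᵇ k ] + [ weakᵇ k ]) cross-split ⟩
        X + a + b + c
          ≡⟨ trans (+-assoc (X + a) b c) (+-assoc X a (b + c)) ⟩
        X + (a + (b + c))
          ≡⟨ cong (X +_) arcs-at-k ⟩
        X + suc [ suc k <ᵇ f k ]
          ≡⟨ +-suc X _ ⟩
        1 + cross (suc k) ∎
      where
      open ≡-Reasoning
      X = ∑ k (λ j → [ suc k <ᵇ f j ])
      a = [ g (suc k) <ᵇ k ]
      b = [ k <ᵇ f k ]
      c = [ k <ᵇ g (suc k) ]
      sk<n : suc k < n
      sk<n = s<s k<m
      k<n : k < n
      k<n = m<n⇒m<1+n k<m
      cross-split : cross k ≡ X + a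
      cross-split = trans (∑-cong k (λ j _ → [<]-split-suc k (f j)))
        (trans (∑-+ k _ _) (cong (X +_) (count-value≡ (suc k) k sk<n (<⇒≤ k<n))))
      arcs-at-k : a + (b + c) ≡ suc [ suc k <ᵇ f k ]
      arcs-at-k with f k ≡ᵇ suc k | ≡ᵇ-reflects (f k) (suc k)
      ... | true | ofʸ e rewrite e | trans (cong g (sym e)) (gf k k<n) | n<ᵇ1+n k | n<ᵇn k = refl
      ... | false | ofⁿ ne = begin
          a + (b + c) ≡⟨ trans (cong (a +_) (+-comm b c)) (sym (+-assoc a c b)) ⟩
          a + c + b   ≡⟨ cong (_+ b) ([<]+[>]≡1 (g (suc k)) k g[1+k]≢k) ⟩
          suc b       ≡⟨ cong suc ([<]-skip-suc k (f k) ne) ⟩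
          suc [ suc k <ᵇ f k ] ∎
        where
        g[1+k]≢k : g (suc k) ≢ k
        g[1+k]≢k e = ne (trans (cong f (sym e)) (fg (suc k) sk<n))

    cross-formula : ∀ k → k ≤ m → ∑ k ([_] ∘ excᵇ) + ∑ k ([_] ∘ weakᵇ) ≡ k + cross k
    cross-formula zero _ = refl
    cross-formula (suc k) sk≤m = begin
        (E + e) + (W + w)     ≡⟨ interchange E e W w ⟩
        (E + W) + (e + w)     ≡⟨ cong (_+ (e + w)) (cross-formula k (≤-trans (n≤1+n k) sk≤m)) ⟩
        k + cross k + (e + w) ≡⟨ trans (+-assoc k (cross k) (e + w)) (cong (k +_) (sym (+-assoc (cross k) e w))) ⟩
        k + (cross k + e + w) ≡⟨ cong (k +_) (cross-step k sk≤m) ⟩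
        k + suc (cross (suc k)) ≡⟨ +-suc k _ ⟩
        suc k + cross (suc k) ∎
      where
      open ≡-Reasoning
      E = ∑ k ([_] ∘ excᵇ)
      W = ∑ k ([_] ∘ weakᵇ)
      e = [ excᵇ k ]
      w = [ weakᵇ k ]

    -- No arc passes beyond the last position: the path returns to height 0.
    cross-last : cross m ≡ 0
    cross-last = ∑-zero m (λ j j<m → no-arc j j<m)
      where
      no-arc : ∀ j → j < m → [ m <ᵇ f j ] ≡ 0
      no-arc j j<m = cong [_] (<ᵇ-false (<⇒≱ (f< j (m<n⇒m<1+n j<m))))

    -- Positions before i split into those with value below i and the arcs over gap i.
    count-below : ∀ i → i < n → ∑ i (λ b → [ f b <ᵇ i ]) + cross i + [ g i <ᵇ i ] ≡ i
    count-below i i<n = begin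
        ∑ i (λ b → [ f b <ᵇ i ]) + cross i + [ g i <ᵇ i ]
          ≡⟨ cong (∑ i (λ b → [ f b <ᵇ i ]) + cross i +_) (sym (count-value≡ i i i<n (<⇒≤ i<n))) ⟩
        ∑ i (λ b → [ f b <ᵇ i ]) + cross i + ∑ i (λ b → [ f b ≡ᵇ i ])
          ≡⟨ sym (trans (∑-+ i _ _) (cong (_+ ∑ i (λ b → [ f b ≡ᵇ i ])) (∑-+ i _ _))) ⟩
        ∑ i (λ b → [ f b <ᵇ i ] + [ i <ᵇ f b ] + [ f b ≡ᵇ i ])
          ≡⟨ ∑-cong i (λ b _ → [<]+[>]+[≡]≡1 (f b) i) ⟩
        ∑ i (λ _ → 1)
          ≡⟨ ∑-one i ⟩
        i ∎
      where open ≡-Reasoning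

    μ≤cross : ∀ i → i < n → μ i ≤ cross i
    μ≤cross i i<n with excᵇ i | <ᵇ-reflects-< i (f i)
    ... | true | ofʸ i<fi = ∑-mono i (λ b _ → larger-crosses (f b))
      where
      -- an earlier value above σ i > i spans the gap i
      larger-crosses : ∀ y → [ f i <ᵇ y ] ≤ [ i <ᵇ y ]
      larger-crosses y with f i <ᵇ y | <ᵇ-reflects-< (f i) y | i <ᵇ y | <ᵇ-reflects-< i y
      ... | true | ofʸ p | true | _ = ≤-refl
      ... | true | ofʸ p | false | ofⁿ q = contradiction (<-trans i<fi p) q
      ... | false | _ | _ | _ = z≤n
    ... | false | ofⁿ ¬exc = ≤-trans (∑-mono n (λ b _ → smaller-below b)) later≤cross
      where
      -- later values below σ i ≤ i are below i, and there are at most cross i of those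
      fi≤i : f i ≤ i
      fi≤i = ≮⇒≥ ¬exc
      h : ℕ → ℕ
      h b = [ f b <ᵇ i ]
      later = ∑ n (λ b → (i <ᵇ b) ?· h b)
      smaller-below : ∀ b → (i <ᵇ b) ?· [ f b <ᵇ f i ] ≤ (i <ᵇ b) ?· h b
      smaller-below b with i <ᵇ b
      ... | false = z≤n
      ... | true with f b <ᵇ f i | <ᵇ-reflects-< (f b) (f i) | f b <ᵇ i | <ᵇ-reflects-< (f b) i
      ...   | true | ofʸ p | true | _ = ≤-refl
      ...   | true | ofʸ p | false | ofⁿ q = contradiction (<-≤-trans p fi≤i) q
      ...   | false | _ | _ | _ = z≤n
      two-counts : h i + later ≡ cross i + [ g i <ᵇ i ]
      two-counts = +-cancelˡ-≡ (∑ i h) _ _ (begin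
        ∑ i h + (h i + later)            ≡⟨ sym (+-assoc (∑ i h) (h i) later) ⟩
        ∑ i h + h i + later              ≡⟨ sym (∑-split n i h i<n) ⟩
        ∑ n h                            ≡⟨ count-values< i (<⇒≤ i<n) ⟩
        i                                ≡⟨ sym (count-below i i<n) ⟩
        ∑ i h + cross i + [ g i <ᵇ i ]   ≡⟨ +-assoc (∑ i h) _ _ ⟩
        ∑ i h + (cross i + [ g i <ᵇ i ]) ∎)
        where open ≡-Reasoning
      preimage-below : [ g i <ᵇ i ] ≤ h i
      preimage-below with g i <ᵇ i | <ᵇ-reflects-< (g i) i | f i <ᵇ i | <ᵇ-reflects-< (f i) i
      ... | true | ofʸ p | true | _ = ≤-refl
      ... | true | ofʸ p | false | ofⁿ q with m≤n⇒m<n∨m≡n fi≤i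
      ...   | inj₁ lt = contradiction lt q
      ...   | inj₂ eq = contradiction (subst (_< i) (trans (cong g (sym eq)) (gf i i<n)) p) (n≮n i)
      preimage-below | false | _ | _ | _ = z≤n
      later≤cross : later ≤ cross i
      later≤cross = +-cancelʳ-≤ (h i) later (cross i)
        (subst (_≤ cross i + h i) (trans (sym two-counts) (+-comm (h i) later)) (+-monoʳ-≤ (cross i) preimage-below))

    laterSmaller : ℕ → ℕ
    laterSmaller a = ∑ n (λ b → (a <ᵇ b) ?· [ f b <ᵇ f a ])

    between : ℕ → ℕ
    between a = ∑ m (λ i → (a <ᵇ i) ?· [ i <ᵇ f a ])

    inversions-at : ∀ a → a < n → laterSmaller a ≡ [ excᵇ a ] + between a + μ a
    inversions-at a a<n with excᵇ a | <ᵇ-reflects-< a (f a)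
    ... | false | ofⁿ ¬exc = sym (cong (_+ laterSmaller a) (∑-zero m (λ i _ → no-gap i)))
      where
      no-gap : ∀ i → (a <ᵇ i) ?· [ i <ᵇ f a ] ≡ 0
      no-gap i with a <ᵇ i | <ᵇ-reflects-< a i
      ... | false | _ = refl
      ... | true | ofʸ p with i <ᵇ f a | <ᵇ-reflects-< i (f a)
      ...   | true | ofʸ q = contradiction (<-trans p q) ¬exc
      ...   | false | _ = refl
    ... | true | ofʸ a<fa = +-cancelʳ-≡ a _ _ (begin
        laterSmaller a + a                    ≡⟨ cong (laterSmaller a +_) (sym earlier) ⟩
        laterSmaller a + (∑ a h + M)          ≡⟨ regroup₁ (laterSmaller a) (∑ a h) M ⟩
        ∑ a h + laterSmaller a + M            ≡⟨ cong (_+ M) values-below ⟩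
        f a + M                               ≡⟨ cong (_+ M) (sym gaps) ⟩
        suc a + between a + M                 ≡⟨ regroup₂ a (between a) M ⟩
        1 + between a + M + a ∎)
      where
      open ≡-Reasoning
      fa<n = f< a a<n
      h : ℕ → ℕ
      h b = [ f b <ᵇ f a ]
      M = ∑ a (λ b → [ f a <ᵇ f b ])
      values-below : ∑ a h + laterSmaller a ≡ f a
      values-below = begin
        ∑ a h + laterSmaller a            ≡⟨ cong (λ z → z + laterSmaller a) (sym (+-identityʳ (∑ a h))) ⟩
        ∑ a h + 0 + laterSmaller a        ≡⟨ cong (λ z → ∑ a h + z + laterSmaller a) (sym (cong [_] (n<ᵇn (f a)))) ⟩
        ∑ a h + h a + laterSmaller a      ≡⟨ sym (∑-split n a h a<n) ⟩
        ∑ n h                             ≡⟨ count-values< (f a) (<⇒≤ fa<n) ⟩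
        f a ∎
      -- each earlier value is either below or above σ a
      earlier : ∑ a h + M ≡ a
      earlier = trans (sym (∑-+ a _ _)) (trans (∑-cong a (λ b b<a → below-or-above b b<a)) (∑-one a))
        where
        below-or-above : ∀ b → b < a → h b + [ f a <ᵇ f b ] ≡ 1
        below-or-above b b<a = [<]+[>]≡1 (f b) (f a) (λ e → <⇒≢ b<a (f-inj (<-trans b<a a<n) a<n e))
      -- the gaps below σ a are the a + 1 gaps up to a and the spanned ones
      gaps : suc a + between a ≡ f a
      gaps = trans (cong (_+ between a) (sym (∑-count< m (suc a) (≤-trans a<fa (≤-pred fa<n)))))
            (trans (sym (∑-+ m _ _)) (trans (sym (∑-cong m (λ i _ → split-at-a i))) (∑-count< m (f a) (≤-pred fa<n))))
        where
        split-at-a : ∀ i → [ i <ᵇ f a ] ≡ [ i <ᵇ suc a ] + (a <ᵇ i) ?· [ i <ᵇ f a ]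
        split-at-a i with a <ᵇ i | <ᵇ-reflects-< a i | i <ᵇ suc a | <ᵇ-reflects-< i (suc a)
        ... | true | ofʸ p | true | ofʸ q = contradiction (<-≤-trans p (≤-pred q)) (n≮n a)
        ... | true | _ | false | _ = refl
        ... | false | ofⁿ p | true | ofʸ q rewrite <ᵇ-true (<-≤-trans q a<fa) = refl
        ... | false | ofⁿ p | false | ofⁿ q = contradiction (s≤s (≮⇒≥ p)) q
      regroup₁ : ∀ (x y z : ℕ) → x + (y + z) ≡ y + x + z
      regroup₁ = solve-∀
      regroup₂ : ∀ (x y z : ℕ) → suc x + y + z ≡ 1 + y + z + x
      regroup₂ = solve-∀

    excᵇ-last : excᵇ m ≡ false
    excᵇ-last = <ᵇ-false (<⇒≱ (f< m ≤-refl))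

    μ-last : μ m ≡ 0
    μ-last with excᵇ m | <ᵇ-reflects-< m (f m)
    ... | true | ofʸ p = contradiction (f< m ≤-refl) (<⇒≱ (s<s p))
    ... | false | _ = ∑-zero n (λ b b<n → nothing-later b b<n)
      where
      nothing-later : ∀ b → b < n → (m <ᵇ b) ?· [ f b <ᵇ f m ] ≡ 0
      nothing-later b b<n rewrite <ᵇ-false {m} {b} (<⇒≱ (s<s (≤-pred b<n))) = refl

    -- Counting pairs (arc at a, spanned gap i) by gaps: the total height is the area.
    ∑between≡∑cross : ∑ n between ≡ ∑ m cross
    ∑between≡∑cross = trans (∑-swap n m (λ a i → (a <ᵇ i) ?· [ i <ᵇ f a ]))
      (∑-cong m (λ i i<m → ∑-restrict′ n i (λ a → [ i <ᵇ f a ]) (<⇒≤ (m<n⇒m<1+n i<m))))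

    inversion-decomposition : ∑ n (λ a → ∑ n (λ b → [ (a <ᵇ b) ∧ (f b <ᵇ f a) ])) ≡ ∑ n ([_] ∘ excᵇ) + (∑ m cross + ∑ m μ)
    inversion-decomposition = begin
        ∑ n (λ a → ∑ n (λ b → [ (a <ᵇ b) ∧ (f b <ᵇ f a) ]))
          ≡⟨ ∑-cong n (λ a a<n → trans (∑-cong n (λ b _ → [∧] (a <ᵇ b) (f b <ᵇ f a))) (inversions-at a a<n)) ⟩
        ∑ n (λ a → [ excᵇ a ] + between a + μ a)
          ≡⟨ trans (∑-+ n _ _) (cong (_+ ∑ n μ) (∑-+ n _ _)) ⟩
        ∑ n ([_] ∘ excᵇ) + ∑ n between + ∑ n μ
          ≡⟨ cong₂ (λ x y → ∑ n ([_] ∘ excᵇ) + x + y) ∑between≡∑cross (trans (cong (∑ m μ +_) μ-last) (+-identityʳ _)) ⟩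
        ∑ n ([_] ∘ excᵇ) + ∑ m cross + ∑ m μ
          ≡⟨ +-assoc (∑ n ([_] ∘ excᵇ)) _ _ ⟩
        ∑ n ([_] ∘ excᵇ) + (∑ m cross + ∑ m μ) ∎
      where open ≡-Reasoning

    excᵇ-preimage : ∀ u → u < n → excᵇ (g u) ≡ (g u <ᵇ u)
    excᵇ-preimage u u<n = cong (g u <ᵇ_) (fg u u<n)

    freeBelow : ℕ → ℕ → Bool
    freeBelow p u = (u <ᵇ suc p) ∧ not (g u <ᵇ p)

    rank-weak : ∀ p → p < n → excᵇ p ≡ false → freeBelow p (f p) ≡ true × ∑ (f p) ([_] ∘ freeBelow p) ≡ μ p
    rank-weak p p<n ex = mem , cnt
      where
      fp≤p = excᵇ-false ex
      mem : freeBelow p (f p) ≡ true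
      mem rewrite gf p p<n | <ᵇ-true (s≤s fp≤p) | n<ᵇn p = refl
      below-σp : ∀ v → v < f p → [ freeBelow p v ] ≡ [ p <ᵇ g v ]
      below-σp v v<fp rewrite <ᵇ-true (<-≤-trans v<fp (m≤n⇒m≤1+n fp≤p)) with g v <ᵇ p | <ᵇ-reflects-< (g v) p | p <ᵇ g v | <ᵇ-reflects-< p (g v)
      ... | true | ofʸ a | true | ofʸ b = contradiction (<-trans a b) (n≮n (g v))
      ... | true | _ | false | _ = refl
      ... | false | _ | true | _ = refl
      ... | false | ofⁿ a | false | ofⁿ b with <-cmp (g v) p
      ...   | tri< x _ _ = contradiction x a
      ...   | tri> _ _ z = contradiction z b
      ...   | tri≈ _ e _ = contradiction (subst (_< f p) (trans (sym (fg v (<-trans v<fp (f< p p<n)))) (cong f e)) v<fp) (n≮n (f p))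
      cnt : ∑ (f p) ([_] ∘ freeBelow p) ≡ μ p
      cnt = begin
        ∑ (f p) ([_] ∘ freeBelow p) ≡⟨ ∑-cong (f p) below-σp ⟩
        ∑ (f p) (λ v → [ p <ᵇ g v ]) ≡⟨ sym (∑-restrict′ n (f p) (λ v → [ p <ᵇ g v ]) (<⇒≤ (f< p p<n))) ⟩
        ∑ n (λ v → (v <ᵇ f p) ?· [ p <ᵇ g v ]) ≡⟨ ∑-reindex (λ v → (v <ᵇ f p) ?· [ p <ᵇ g v ]) ⟩
        ∑ n (λ b → (f b <ᵇ f p) ?· [ p <ᵇ g (f b) ]) ≡⟨ ∑-cong n (λ b b<n → trans (cong (λ z → (f b <ᵇ f p) ?· [ p <ᵇ z ]) (gf b b<n)) (?·-swap (f b <ᵇ f p) (p <ᵇ b))) ⟩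
        ∑ n (λ b → (p <ᵇ b) ?· [ f b <ᵇ f p ]) ≡⟨ sym (μ-nonexc p ex) ⟩
        μ p ∎
        where open ≡-Reasoning

    freeAbove : ℕ → ℕ → Bool
    freeAbove q u = (q <ᵇ u) ∧ not (q <ᵇ g u)

    rank-exc : ∀ q → q < n → excᵇ q ≡ true →
            freeAbove q (f q) ≡ true × ∑ (f q) ([_] ∘ freeAbove q) + suc (μ q) ≡ ∑ n ([_] ∘ freeAbove q)
    rank-exc q q<n ex = mem , cnt
      where
      q<fq = excᵇ-true ex
      fq<n = f< q q<n
      mem : freeAbove q (f q) ≡ true
      mem rewrite gf q q<n | <ᵇ-true q<fq | n<ᵇn q = refl
      above-σq : ∀ v → v < n → (f q <ᵇ v) ?· [ freeAbove q v ] ≡ (f q <ᵇ v) ?· [ g v <ᵇ q ]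
      above-σq v v<n with f q <ᵇ v | <ᵇ-reflects-< (f q) v
      ... | false | _ = refl
      ... | true | ofʸ fq<v rewrite <ᵇ-true (<-trans q<fq fq<v) with q <ᵇ g v | <ᵇ-reflects-< q (g v) | g v <ᵇ q | <ᵇ-reflects-< (g v) q
      ...   | true | ofʸ a | true | ofʸ b = contradiction (<-trans a b) (n≮n q)
      ...   | true | _ | false | _ = refl
      ...   | false | _ | true | _ = refl
      ...   | false | ofⁿ a | false | ofⁿ b with <-cmp (g v) q
      ...     | tri< x _ _ = contradiction x b
      ...     | tri> _ _ z = contradiction z a
      ...     | tri≈ _ e _ = contradiction (subst (f q <_) (trans (sym (fg v v<n)) (cong f e)) fq<v) (n≮n (f q))
      larger-than-σq : ∑ n (λ v → (f q <ᵇ v) ?· [ freeAbove q v ]) ≡ μ q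
      larger-than-σq = begin
        ∑ n (λ v → (f q <ᵇ v) ?· [ freeAbove q v ]) ≡⟨ ∑-cong n above-σq ⟩
        ∑ n (λ v → (f q <ᵇ v) ?· [ g v <ᵇ q ]) ≡⟨ ∑-reindex _ ⟩
        ∑ n (λ b → (f q <ᵇ f b) ?· [ g (f b) <ᵇ q ]) ≡⟨ ∑-cong n (λ b b<n → trans (cong (λ z → (f q <ᵇ f b) ?· [ z <ᵇ q ]) (gf b b<n)) (?·-swap (f q <ᵇ f b) (b <ᵇ q))) ⟩
        ∑ n (λ b → (b <ᵇ q) ?· [ f q <ᵇ f b ]) ≡⟨ ∑-restrict′ n q _ (<⇒≤ q<n) ⟩
        ∑ q (λ b → [ f q <ᵇ f b ]) ≡⟨ sym (μ-exc q ex) ⟩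
        μ q ∎
        where open ≡-Reasoning
      cnt : ∑ (f q) ([_] ∘ freeAbove q) + suc (μ q) ≡ ∑ n ([_] ∘ freeAbove q)
      cnt = begin
        ∑ (f q) ([_] ∘ freeAbove q) + suc (μ q) ≡⟨ sym (+-assoc (∑ (f q) ([_] ∘ freeAbove q)) 1 (μ q)) ⟩
        ∑ (f q) ([_] ∘ freeAbove q) + 1 + μ q ≡⟨ cong₂ (λ x y → ∑ (f q) ([_] ∘ freeAbove q) + x + y) (sym (cong [_] mem)) (sym larger-than-σq) ⟩
        ∑ (f q) ([_] ∘ freeAbove q) + [ freeAbove q (f q) ] + ∑ n (λ v → (f q <ᵇ v) ?· [ freeAbove q v ]) ≡⟨ sym (∑-split n (f q) ([_] ∘ freeAbove q) fq<n) ⟩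
        ∑ n ([_] ∘ freeAbove q) ∎
        where open ≡-Reasoning


module Selection where

  open FiniteSums
  open import Defs using ([_])
  open import Data.Nat using (ℕ; zero; suc; _+_; _<_; z<s; _≡ᵇ_)
  open import Data.Nat.Properties
  open import Data.Bool using (Bool; true; false; if_then_else_; _∧_)
  open import Relation.Nullary.Negation using (contradiction)
  open import Relation.Nullary.Reflects using (ofʸ; ofⁿ)
  open import Relation.Binary.PropositionalEquality hiding ([_])
  open import Function using (_∘_)
  open import Data.Product using (_×_; _,_)
  open import Data.Sum using (inj₁; inj₂)

  rank : (ℕ → Bool) → ℕ → ℕ
  rank A u = ∑ u ([_] ∘ A)

  select : ℕ → (ℕ → Bool) → ℕ → ℕ
  select zero A k = 0
  select (suc N) A k = if A N ∧ (rank A N ≡ᵇ k) then N else select N A k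

  select-spec : ∀ N A k → k < rank A N → select N A k < N × A (select N A k) ≡ true × rank A (select N A k) ≡ k
  select-spec zero A k ()
  select-spec (suc N) A k k< with A N in eqA | rank A N ≡ᵇ k | ≡ᵇ-reflects (rank A N) k
  ... | true | true | ofʸ e = ≤-refl , eqA , e
  ... | true | false | ofⁿ ne = let (a , b , c) = select-spec N A k k<′ in m<n⇒m<1+n a , b , c
    where
    k<′ : k < rank A N
    k<′ = ≤∧≢⇒< (≤-pred (subst (k <_) (+-comm (rank A N) 1) k<)) (λ e → ne (sym e))
  ... | false | _ | _ = let (a , b , c) = select-spec N A k (subst (k <_) (+-identityʳ _) k<) in m<n⇒m<1+n a , b , c

  -- Ranks of elements of A are distinct, so the element of a given rank is unique.
  select-unique : ∀ N A k u → u < N → A u ≡ true → rank A u ≡ k → select N A k ≡ u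
  select-unique zero A k u () _ _
  select-unique (suc N) A k u u<1+N Au ru with m≤n⇒m<n∨m≡n (≤-pred u<1+N)
  ... | inj₂ refl rewrite Au | ru | ≡ᵇ-self k = refl
  ... | inj₁ u<N with A N | rank A N ≡ᵇ k | ≡ᵇ-reflects (rank A N) k
  ...   | true | true | ofʸ e = contradiction (trans ru (sym e)) (<⇒≢ rank<)
    where
    rank< : rank A u < rank A N
    rank< = <-≤-trans (subst (λ b → rank A u < rank A u + [ b ]) (sym Au) (m<m+n (rank A u) z<s))
                      (∑-mono-range ([_] ∘ A) u<N)
  ...   | true | false | _ = select-unique N A k u u<N Au ru
  ...   | false | _ | _ = select-unique N A k u u<N Au ru

  select-cong : ∀ N (A B : ℕ → Bool) k → (∀ u → u < N → A u ≡ B u) → select N A k ≡ select N B k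
  select-cong zero A B k e = refl
  select-cong (suc N) A B k e
    rewrite e N ≤-refl | ∑-cong N {[_] ∘ A} {[_] ∘ B} (λ u u< → cong [_] (e u (m<n⇒m<1+n u<)))
          | select-cong N A B k (λ u u< → e u (m<n⇒m<1+n u<)) = refl


module Decoding where

  open FiniteSums
  open NatPermutations
  open Selection
  open Encoding using (module Code; mkStep)
  open import Defs using (Step; U; D; L₀; L₁; isUorL₁)
  open import Data.Nat using (ℕ; zero; suc; _+_; _∸_; _≤_; _<_; s≤s; _<ᵇ_; _≡ᵇ_)
  open import Data.Nat.Properties
  open import Data.Bool using (Bool; true; false; if_then_else_; _∧_; _∨_; not)
  open import Data.Bool.Properties using (∨-identityʳ; ∨-zeroʳ; ∧-zeroʳ; ∧-identityʳ)
  open import Relation.Nullary.Negation using (contradiction)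
  open import Relation.Nullary.Reflects using (ofʸ; ofⁿ)
  open import Relation.Binary.PropositionalEquality hiding ([_])

  isUorL₀ : Step → Bool
  isUorL₀ U = true
  isUorL₀ L₀ = true
  isUorL₀ L₁ = false
  isUorL₀ D = false

  isUorL₁-mkStep : ∀ a b → isUorL₁ (mkStep a b) ≡ a
  isUorL₁-mkStep true true = refl
  isUorL₁-mkStep true false = refl
  isUorL₁-mkStep false true = refl
  isUorL₁-mkStep false false = refl

  isUorL₀-mkStep : ∀ a b → isUorL₀ (mkStep a b) ≡ b
  isUorL₀-mkStep true true = refl
  isUorL₀-mkStep true false = refl
  isUorL₀-mkStep false true = refl
  isUorL₀-mkStep false false = refl

  mkStep-bits : ∀ x → mkStep (isUorL₁ x) (isUorL₀ x) ≡ x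
  mkStep-bits U = refl
  mkStep-bits D = refl
  mkStep-bits L₀ = refl
  mkStep-bits L₁ = refl

  -- The decoder reads a history as a step function s and weights r on [0, m).
  -- Non-excedances are decoded left to right, σ p being the element of rank r p among
  -- the unused weak values u ≤ p; excedances are decoded right to left (t = m ∸ p),
  -- σ p being the unused non-weak value u > p with exactly r p larger candidates.
  module Decoder (m : ℕ) (s : ℕ → Step) (r : ℕ → ℕ) where
    n : ℕ
    n = suc m

    -- p is read as an excedance (the last position never is).
    excPos : ℕ → Bool
    excPos p = (p <ᵇ m) ∧ isUorL₁ (s p)

    weakValue : ℕ → Bool
    weakValue zero = true
    weakValue (suc i) = isUorL₀ (s i)

    weight′ : ℕ → ℕ
    weight′ p = if p <ᵇ m then r p else 0

    mutual
      usedWeak : ℕ → ℕ → Bool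
      usedWeak zero u = false
      usedWeak (suc p) u = usedWeak p u ∨ (not (excPos p) ∧ (pickWeak p ≡ᵇ u))

      availWeak : ℕ → ℕ → Bool
      availWeak p u = (u <ᵇ suc p) ∧ (weakValue u ∧ not (usedWeak p u))

      pickWeak : ℕ → ℕ
      pickWeak p = select n (availWeak p) (weight′ p)

    mutual
      usedExc : ℕ → ℕ → Bool
      usedExc zero u = false
      usedExc (suc t) u = usedExc t u ∨ (excPos (m ∸ t) ∧ (pickExc t ≡ᵇ u))

      availExc : ℕ → ℕ → Bool
      availExc t u = ((m ∸ t) <ᵇ u) ∧ (not (weakValue u) ∧ not (usedExc t u))

      pickExc : ℕ → ℕ
      pickExc t = select n (availExc t) (rank (availExc t) n ∸ suc (r (m ∸ t)))

    decode : ℕ → ℕ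
    decode p = if excPos p then pickExc (m ∸ p) else pickWeak p

  -- Running the decoder next to a permutation P whose step bits it reads correctly,
  -- the sets of used values are the true ones as long as the earlier picks were right;
  -- hence the candidate sets are the sets freeBelow and freeAbove of Code P.
  module Agreement (m : ℕ) (s : ℕ → Step) (r : ℕ → ℕ) (P : PermN (suc m)) where
    open Decoder m s r
    open PermN P
    open Code P hiding (n)

    module Consistent (excPos≡excᵇ : ∀ p → p < n → excPos p ≡ excᵇ p)
               (weakValue≡ : ∀ u → u < n → weakValue u ≡ not (g u <ᵇ u)) where

      UsedWeakInv : ℕ → Set
      UsedWeakInv p = ∀ u → u < n → usedWeak p u ≡ ((g u <ᵇ p) ∧ not (excᵇ (g u)))

      availWeak-correct : ∀ p → UsedWeakInv p → ∀ u → u < n → availWeak p u ≡ freeBelow p u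
      availWeak-correct p usedInv u u<n rewrite weakValue≡ u u<n | usedInv u u<n | excᵇ-preimage u u<n
        with u <ᵇ suc p | <ᵇ-reflects-< u (suc p)
      ... | false | _ = refl
      ... | true | ofʸ u≤p with g u <ᵇ u | <ᵇ-reflects-< (g u) u
      ...   | false | _ = cong not (∧-identityʳ _)
      ...   | true | ofʸ gu<u rewrite <ᵇ-true (<-≤-trans gu<u (≤-pred u≤p)) = refl

      usedWeakInv-zero : UsedWeakInv 0
      usedWeakInv-zero u _ = refl

      usedWeakInv-suc : ∀ p → p < n → UsedWeakInv p → (excᵇ p ≡ false → pickWeak p ≡ f p) → UsedWeakInv (suc p)
      usedWeakInv-suc p p<n usedInv correctPick u u<n rewrite usedInv u u<n | excPos≡excᵇ p p<n | <ᵇ-suc (g u) p with excᵇ p in ex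
      ... | true with g u ≡ᵇ p | ≡ᵇ-reflects (g u) p
      ...   | true | ofʸ e rewrite e | ex | n<ᵇn p = refl
      ...   | false | _ = trans (∨-identityʳ _) (sym (cong (_∧ not (excᵇ (g u))) (∨-identityʳ (g u <ᵇ p))))
      usedWeakInv-suc p p<n usedInv correctPick u u<n | false rewrite correctPick refl with g u ≡ᵇ p | ≡ᵇ-reflects (g u) p | f p ≡ᵇ u | ≡ᵇ-reflects (f p) u
      ... | true | ofʸ e | true | _ rewrite e | ex | n<ᵇn p = refl
      ... | true | ofʸ e | false | ofⁿ ne = contradiction (trans (cong f (sym e)) (fg u u<n)) ne
      ... | false | ofⁿ ne | true | ofʸ e = contradiction (trans (cong g (sym e)) (gf p p<n)) ne
      ... | false | _ | false | _ = trans (∨-identityʳ _) (sym (cong (_∧ not (excᵇ (g u))) (∨-identityʳ (g u <ᵇ p))))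

      UsedExcInv : ℕ → Set
      UsedExcInv t = ∀ u → u < n → usedExc t u ≡ ((m <ᵇ g u + t) ∧ excᵇ (g u))

      availExc-correct : ∀ t → t ≤ m → UsedExcInv t → ∀ u → u < n → availExc t u ≡ freeAbove (m ∸ t) u
      availExc-correct t t≤m usedInv u u<n rewrite weakValue≡ u u<n | usedInv u u<n | excᵇ-preimage u u<n | <ᵇ-∸ m t (g u) t≤m
        with (m ∸ t) <ᵇ u | <ᵇ-reflects-< (m ∸ t) u
      ... | false | _ = refl
      ... | true | ofʸ q<u with g u <ᵇ u | <ᵇ-reflects-< (g u) u
      ...   | true | _ = cong not (∧-identityʳ _)
      ...   | false | ofⁿ gu≮u rewrite <ᵇ-true (<-≤-trans q<u (≮⇒≥ gu≮u)) = refl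

      usedExcInv-zero : UsedExcInv 0
      usedExcInv-zero u u<n rewrite +-identityʳ (g u) | <ᵇ-false {m} {g u} (<⇒≱ (s≤s (≤-pred (g< u u<n)))) = refl

      usedExcInv-suc : ∀ t → t ≤ m → UsedExcInv t → (excᵇ (m ∸ t) ≡ true → pickExc t ≡ f (m ∸ t)) → UsedExcInv (suc t)
      usedExcInv-suc t t≤m usedInv correctPick u u<n rewrite usedInv u u<n | excPos≡excᵇ (m ∸ t) (s≤s (m∸n≤m m t)) | +-suc (g u) t | <ᵇ-suc m (g u + t) | ≡ᵇ-∸ m t (g u) t≤m
        with excᵇ (m ∸ t) in ex
      ... | false with g u ≡ᵇ (m ∸ t) | ≡ᵇ-reflects (g u) (m ∸ t)
      ...   | true | ofʸ e rewrite e | ex = trans (∨-identityʳ _) (trans (∧-zeroʳ _) (sym (∧-zeroʳ _)))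
      ...   | false | _ = trans (∨-identityʳ _) (cong (_∧ excᵇ (g u)) (sym (∨-identityʳ _)))
      usedExcInv-suc t t≤m usedInv correctPick u u<n | true rewrite correctPick refl with g u ≡ᵇ (m ∸ t) | ≡ᵇ-reflects (g u) (m ∸ t) | f (m ∸ t) ≡ᵇ u | ≡ᵇ-reflects (f (m ∸ t)) u
      ... | true | ofʸ e | true | _ rewrite e | ex = trans (∨-zeroʳ _) (sym (trans (∧-identityʳ _) (∨-zeroʳ _)))
      ... | true | ofʸ e | false | ofⁿ ne = contradiction (trans (cong f (sym e)) (fg u u<n)) ne
      ... | false | ofⁿ ne | true | ofʸ e = contradiction (trans (cong g (sym e)) (gf (m ∸ t) (s≤s (m∸n≤m m t)))) ne
      ... | false | _ | false | _ = trans (∨-identityʳ _) (cong (_∧ excᵇ (g u)) (sym (∨-identityʳ _)))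


module LeftInverse where

  open FiniteSums
  open NatPermutations
  open Selection
  open Encoding using (module Code)
  open Decoding
  open import Defs using (Step; [_])
  open import Data.Nat using (ℕ; zero; suc; _∸_; _≤_; _<_; s≤s; _<ᵇ_)
  open import Data.Nat.Properties
  open import Data.Bool using (true; false; if_then_else_; not)
  open import Relation.Nullary.Negation using (contradiction)
  open import Relation.Binary.PropositionalEquality hiding ([_])
  open import Function using (_∘_)
  open import Data.Product using (proj₁; proj₂)
  open import Data.Sum using (inj₁; inj₂)

  -- The decoder is fed the steps and weights of Code P (on [0, m)); by induction along
  -- both decoding orders every pick is the true value of P.
  module DecodeCode (m : ℕ) (P : PermN (suc m)) (s : ℕ → Step) (r : ℕ → ℕ)
    (hs : ∀ p → p < m → s p ≡ Code.step P p)
    (hr : ∀ p → p < m → r p ≡ Code.μ P p) where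
    open Decoder m s r
    open PermN P
    open Code P hiding (n)
    open Agreement m s r P

    excPos≡excᵇ : ∀ p → p < n → excPos p ≡ excᵇ p
    excPos≡excᵇ p p<n with m≤n⇒m<n∨m≡n (≤-pred p<n)
    ... | inj₁ p<m rewrite <ᵇ-true p<m | hs p p<m = isUorL₁-mkStep (excᵇ p) (weakᵇ p)
    ... | inj₂ refl rewrite n<ᵇn m = sym excᵇ-last

    weakValue≡ : ∀ u → u < n → weakValue u ≡ not (g u <ᵇ u)
    weakValue≡ zero _ = refl
    weakValue≡ (suc i) si<n rewrite hs i (≤-pred si<n) | isUorL₀-mkStep (excᵇ i) (weakᵇ i) =
      weakᵇ≡ i

    open Consistent excPos≡excᵇ weakValue≡

    weight′≡μ : ∀ p → p < n → weight′ p ≡ μ p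
    weight′≡μ p p<n with m≤n⇒m<n∨m≡n (≤-pred p<n)
    ... | inj₁ p<m = trans (cong (λ c → if c then r p else 0) (<ᵇ-true p<m)) (hr p p<m)
    ... | inj₂ refl = trans (cong (λ c → if c then r m else 0) (n<ᵇn m)) (sym μ-last)

    pickWeak-correct : ∀ p → p < n → UsedWeakInv p → excᵇ p ≡ false → pickWeak p ≡ f p
    pickWeak-correct p p<n usedInv ex = trans (select-cong n (availWeak p) (freeBelow p) (weight′ p) (availWeak-correct p usedInv))
      (select-unique n (freeBelow p) (weight′ p) (f p) (f< p p<n) (proj₁ (rank-weak p p<n ex)) (trans (proj₂ (rank-weak p p<n ex)) (sym (weight′≡μ p p<n))))

    usedWeakInv-all : ∀ p → p ≤ n → UsedWeakInv p
    usedWeakInv-all zero _ = usedWeakInv-zero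
    usedWeakInv-all (suc p) sp≤n = usedWeakInv-suc p sp≤n (usedWeakInv-all p (≤-trans (n≤1+n p) sp≤n)) (pickWeak-correct p sp≤n (usedWeakInv-all p (≤-trans (n≤1+n p) sp≤n)))

    pickExc-correct : ∀ t → t ≤ m → UsedExcInv t → excᵇ (m ∸ t) ≡ true → pickExc t ≡ f (m ∸ t)
    pickExc-correct t t≤m usedInv ex = trans (select-cong n (availExc t) (freeAbove q) _ (availExc-correct t t≤m usedInv))
        (trans (cong (select n (freeAbove q)) rank≡)
        (select-unique n (freeAbove q) _ (f q) (f< q q<n) (proj₁ (rank-exc q q<n ex)) refl))
      where
      q = m ∸ t
      q<n : q < n
      q<n = s≤s (m∸n≤m m t)
      q<m : q < m
      q<m with m≤n⇒m<n∨m≡n (≤-pred q<n)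
      ... | inj₁ lt = lt
      ... | inj₂ e = contradiction (trans (sym ex) (trans (cong excᵇ e) excᵇ-last)) (λ ())
      rank≡ : ∑ n ([_] ∘ availExc t) ∸ suc (r q) ≡ ∑ (f q) ([_] ∘ freeAbove q)
      rank≡ rewrite ∑-cong n {[_] ∘ availExc t} {[_] ∘ freeAbove q} (λ u u<n → cong [_] (availExc-correct t t≤m usedInv u u<n)) | hr q q<m
        = trans (cong (_∸ suc (μ q)) (sym (proj₂ (rank-exc q q<n ex)))) (m+n∸n≡m _ (suc (μ q)))

    usedExcInv-all : ∀ t → t ≤ m → UsedExcInv t
    usedExcInv-all zero _ = usedExcInv-zero
    usedExcInv-all (suc t) st≤m = usedExcInv-suc t t≤m (usedExcInv-all t t≤m) (pickExc-correct t t≤m (usedExcInv-all t t≤m))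
      where
      t≤m = ≤-trans (n≤1+n t) st≤m

    decode-code : ∀ p → p < n → decode p ≡ f p
    decode-code p p<n rewrite excPos≡excᵇ p p<n with excᵇ p in ex
    ... | false = pickWeak-correct p p<n (usedWeakInv-all p (<⇒≤ p<n)) ex
    ... | true = trans (pickExc-correct (m ∸ p) (m∸n≤m m p) (usedExcInv-all (m ∸ p) (m∸n≤m m p)) (trans (cong excᵇ mmp) ex)) (cong f mmp)
      where
      mmp : m ∸ (m ∸ p) ≡ p
      mmp = m∸[m∸n]≡n (≤-pred p<n)


module DecoderValidity where

  open FiniteSums
  open Selection
  open Decoding
  open import Defs using (Step; U; D; L₀; L₁; isUorL₁; [_])
  open import Data.Nat using (ℕ; zero; suc; _+_; _∸_; _≤_; _<_; s≤s; z<s; _<ᵇ_; _≡ᵇ_)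
  open import Data.Nat.Properties
  open import Data.Bool using (Bool; true; false; _∧_; _∨_; not)
  open import Data.Bool.Properties using (∨-identityʳ; ∨-zeroʳ; ∧-identityʳ)
  open import Relation.Nullary.Negation using (contradiction)
  open import Relation.Nullary.Reflects using (ofʸ)
  open import Relation.Binary.PropositionalEquality hiding ([_])
  open import Relation.Binary using (tri<; tri≈; tri>)
  open import Function using (_∘_)
  open import Data.Product using (_×_; _,_; proj₁; proj₂)
  open import Data.Sum using (inj₁; inj₂)
  open import Data.Nat.Tactic.RingSolver using (solve-∀)

  isUn : Step → ℕ
  isUn U = 1
  isUn D = 0
  isUn L₀ = 0
  isUn L₁ = 0

  isDn : Step → ℕ
  isDn U = 0
  isDn D = 1
  isDn L₀ = 0
  isDn L₁ = 0

  step-balance-weak : ∀ x → [ isUorL₀ x ] + isDn x ≡ isUn x + [ not (isUorL₁ x) ]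
  step-balance-weak U = refl
  step-balance-weak D = refl
  step-balance-weak L₀ = refl
  step-balance-weak L₁ = refl

  step-balance-exc : ∀ x → [ not (isUorL₀ x) ] + isUn x ≡ isDn x + [ isUorL₁ x ]
  step-balance-exc U = refl
  step-balance-exc D = refl
  step-balance-exc L₀ = refl
  step-balance-exc L₁ = refl

  -- V1 says that each weight is at most the height before its step (μ p ≤ h p),
  -- V2 that the path returns to height 0.
  module Valid (m : ℕ) (s : ℕ → Step) (r : ℕ → ℕ)
    (V1 : ∀ p → p < m → r p + ∑ p (isDn ∘ s) ≤ ∑ p (isUn ∘ s))
    (V2 : ∑ m (isUn ∘ s) ≡ ∑ m (isDn ∘ s)) where
    open Decoder m s r

    nonExcPos : ℕ → ℕ
    nonExcPos q = [ not (excPos q) ]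

    nonExcPos-lt : ∀ q → q < m → nonExcPos q ≡ [ not (isUorL₁ (s q)) ]
    nonExcPos-lt q q<m rewrite <ᵇ-true q<m = refl

    availWeak-parts : ∀ p u → availWeak p u ≡ true → u < suc p × weakValue u ≡ true × usedWeak p u ≡ false
    availWeak-parts p u e with u <ᵇ suc p | <ᵇ-reflects-< u (suc p) | e
    ... | true | ofʸ u≤p | e′ with weakValue u | e′
    ...   | true | e″ with usedWeak p u | e″
    ...     | false | _ = u≤p , refl , refl

    availExc-parts : ∀ t u → availExc t u ≡ true → (m ∸ t) < u × weakValue u ≡ false × usedExc t u ≡ false
    availExc-parts t u e with (m ∸ t) <ᵇ u | <ᵇ-reflects-< (m ∸ t) u | e
    ... | true | ofʸ q<u | e′ with weakValue u | e′
    ...   | false | e″ with usedExc t u | e″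
    ...     | false | _ = q<u , refl , refl

    WeakPrefixInv : ℕ → Set
    WeakPrefixInv p = (∀ u → usedWeak p u ≡ true → u < p × weakValue u ≡ true) × ∑ n ([_] ∘ usedWeak p) ≡ ∑ p nonExcPos

    weakPrefixInv-zero : WeakPrefixInv 0
    weakPrefixInv-zero = (λ u ()) , ∑-zero n (λ _ _ → refl)

    count-weak-values : ∀ p → p < n → ∑ n (λ u → [ (u <ᵇ suc p) ∧ weakValue u ]) ≡ suc (∑ p (λ i → [ isUorL₀ (s i) ]))
    count-weak-values p p<n = trans (∑-cong n (λ u _ → [∧] (u <ᵇ suc p) (weakValue u)))
      (trans (∑-restrict′ n (suc p) ([_] ∘ weakValue) p<n) (∑-unfoldˡ p ([_] ∘ weakValue)))

    count-availWeak : ∀ p → p < n → WeakPrefixInv p → ∑ n ([_] ∘ availWeak p) + ∑ p nonExcPos ≡ suc (∑ p (λ i → [ isUorL₀ (s i) ]))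
    count-availWeak p p<n (sub , cnt) = trans (cong (∑ n ([_] ∘ availWeak p) +_) (sym cnt))
      (trans (sym (∑-+ n _ _)) (trans (∑-cong n (λ u _ → avail-or-used u)) (count-weak-values p p<n)))
      where
      avail-or-used : ∀ u → [ availWeak p u ] + [ usedWeak p u ] ≡ [ (u <ᵇ suc p) ∧ weakValue u ]
      avail-or-used u with usedWeak p u in eu
      ... | false rewrite ∧-identityʳ (weakValue u) = +-identityʳ _
      ... | true rewrite <ᵇ-true (m<n⇒m<1+n (proj₁ (sub u eu))) | proj₂ (sub u eu) = refl

    weak-balance : ∀ p → p ≤ m → ∑ p (λ i → [ isUorL₀ (s i) ]) + ∑ p (isDn ∘ s) ≡ ∑ p (isUn ∘ s) + ∑ p nonExcPos
    weak-balance p p≤m = trans (sym (∑-+ p _ _)) (trans (∑-cong p (λ i i<p → trans (step-balance-weak (s i))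
      (cong (isUn (s i) +_) (sym (nonExcPos-lt i (<-≤-trans i<p p≤m)))))) (∑-+ p _ _))

    weight′-bound : ∀ p → p < n → weight′ p + ∑ p (isDn ∘ s) ≤ ∑ p (isUn ∘ s)
    weight′-bound p p<n with m≤n⇒m<n∨m≡n (≤-pred p<n)
    ... | inj₁ p<m rewrite <ᵇ-true p<m = V1 p p<m
    ... | inj₂ refl rewrite n<ᵇn m = ≤-reflexive (sym V2)

    weight′<availableWeak : ∀ p → p < n → WeakPrefixInv p → weight′ p < rank (availWeak p) n
    weight′<availableWeak p p<n prefixInv = +-cancelʳ-< (∑ p nonExcPos) (weight′ p) _
      (subst (weight′ p + ∑ p nonExcPos <_) (sym (count-availWeak p p<n prefixInv)) (s≤s le))
      where
      G = ∑ p (λ i → [ isUorL₀ (s i) ])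
      le : weight′ p + ∑ p nonExcPos ≤ G
      le = +-cancelʳ-≤ (∑ p (isDn ∘ s)) _ _ (begin
        weight′ p + ∑ p nonExcPos + ∑ p (isDn ∘ s) ≡⟨ swap-last (weight′ p) (∑ p nonExcPos) (∑ p (isDn ∘ s)) ⟩
        weight′ p + ∑ p (isDn ∘ s) + ∑ p nonExcPos ≤⟨ +-monoˡ-≤ (∑ p nonExcPos) (weight′-bound p p<n) ⟩
        ∑ p (isUn ∘ s) + ∑ p nonExcPos             ≡⟨ sym (weak-balance p (≤-pred p<n)) ⟩
        G + ∑ p (isDn ∘ s) ∎)
        where
        open ≤-Reasoning
        swap-last : ∀ (a b c : ℕ) → a + b + c ≡ a + c + b
        swap-last = solve-∀

    pickWeak-spec : ∀ p → p < n → WeakPrefixInv p → pickWeak p < n × availWeak p (pickWeak p) ≡ true × rank (availWeak p) (pickWeak p) ≡ weight′ p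
    pickWeak-spec p p<n prefixInv = select-spec n (availWeak p) (weight′ p) (weight′<availableWeak p p<n prefixInv)

    usedWeak-suc-exc : ∀ p → excPos p ≡ true → ∀ u → usedWeak (suc p) u ≡ usedWeak p u
    usedWeak-suc-exc p e u = trans (cong (λ b → usedWeak p u ∨ (not b ∧ (pickWeak p ≡ᵇ u))) e) (∨-identityʳ _)

    usedWeak-suc-weak : ∀ p → excPos p ≡ false → ∀ u → usedWeak (suc p) u ≡ usedWeak p u ∨ (pickWeak p ≡ᵇ u)
    usedWeak-suc-weak p e u = cong (λ b → usedWeak p u ∨ (not b ∧ (pickWeak p ≡ᵇ u))) e

    weakPrefixInv-suc : ∀ p → p < n → WeakPrefixInv p → WeakPrefixInv (suc p)
    weakPrefixInv-suc p p<n (sub , cnt) = step (excPos p) refl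
      where
      step : ∀ b → excPos p ≡ b → WeakPrefixInv (suc p)
      step true ex = (λ u e → let (a , b) = sub u (trans (sym (usedWeak-suc-exc p ex u)) e) in m<n⇒m<1+n a , b)
        , trans (∑-cong n (λ u _ → cong [_] (usedWeak-suc-exc p ex u)))
                (trans cnt (sym (trans (cong (λ c → ∑ p nonExcPos + [ not c ]) ex) (+-identityʳ _))))
      step false ex = sub′ , cnt′
        where
        k = pickWeak p
        sp = pickWeak-spec p p<n (sub , cnt)
        k-parts = availWeak-parts p k (proj₁ (proj₂ sp))
        sub′ : ∀ u → usedWeak (suc p) u ≡ true → u < suc p × weakValue u ≡ true
        sub′ u e with usedWeak p u in eu | trans (sym (usedWeak-suc-weak p ex u)) e
        ... | true | _ = m<n⇒m<1+n (proj₁ (sub u eu)) , proj₂ (sub u eu)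
        ... | false | e′ with k ≡ᵇ u | ≡ᵇ-reflects k u | e′
        ...   | true | ofʸ refl | _ = proj₁ k-parts , proj₁ (proj₂ k-parts)
        cnt′ : ∑ n ([_] ∘ usedWeak (suc p)) ≡ ∑ (suc p) nonExcPos
        cnt′ = begin
          ∑ n ([_] ∘ usedWeak (suc p))             ≡⟨ ∑-cong n (λ u _ → cong [_] (usedWeak-suc-weak p ex u)) ⟩
          ∑ n (λ u → [ usedWeak p u ∨ (k ≡ᵇ u) ]) ≡⟨ ∑-insert n (usedWeak p) k (proj₁ sp) (proj₂ (proj₂ k-parts)) ⟩
          ∑ n ([_] ∘ usedWeak p) + 1               ≡⟨ cong₂ _+_ cnt (cong (λ c → [ not c ]) (sym ex)) ⟩
          ∑ (suc p) nonExcPos ∎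
          where open ≡-Reasoning

    weakPrefixInv-all : ∀ p → p ≤ n → WeakPrefixInv p
    weakPrefixInv-all zero _ = weakPrefixInv-zero
    weakPrefixInv-all (suc p) sp≤n = weakPrefixInv-suc p sp≤n (weakPrefixInv-all p (≤-trans (n≤1+n p) sp≤n))

    excStep : ℕ → ℕ
    excStep i = [ isUorL₁ (s i) ]

    excPool : ℕ → ℕ → Bool
    excPool t u = ((m ∸ t) <ᵇ u) ∧ not (weakValue u)

    ExcSuffixInv : ℕ → Set
    ExcSuffixInv t = (∀ u → usedExc t u ≡ true → (m ∸ t) < u × weakValue u ≡ false) × ∑ n ([_] ∘ usedExc t) ≡ ∑> m (m ∸ t) excStep

    excSuffixInv-zero : ExcSuffixInv 0
    excSuffixInv-zero = (λ u ()) , trans (∑-zero n (λ _ _ → refl))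
      (sym (∑-zero m (λ i i<m → cong (_?· excStep i) (<ᵇ-false {m} {i} (<⇒≱ (m<n⇒m<1+n i<m))))))

    suffix-balance : ∀ q → ∑≥ m q (λ i → [ not (isUorL₀ (s i)) ]) + ∑≥ m q (isUn ∘ s) ≡ ∑≥ m q (isDn ∘ s) + ∑≥ m q excStep
    suffix-balance q = trans (sym (∑-+ m _ _)) (trans (∑-cong m (λ i _ → guarded i)) (∑-+ m _ _))
      where
      guarded : ∀ i → (q <ᵇ suc i) ?· [ not (isUorL₀ (s i)) ] + (q <ᵇ suc i) ?· isUn (s i) ≡ (q <ᵇ suc i) ?· isDn (s i) + (q <ᵇ suc i) ?· excStep i
      guarded i with q <ᵇ suc i
      ... | true = step-balance-exc (s i)
      ... | false = refl

    count-excPool : ∀ t → ∑ n ([_] ∘ excPool t) ≡ ∑≥ m (m ∸ t) (λ i → [ not (isUorL₀ (s i)) ])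
    count-excPool t = trans (∑-unfoldˡ m ([_] ∘ excPool t)) (∑-cong m (λ i _ → [∧] ((m ∸ t) <ᵇ suc i) (not (isUorL₀ (s i)))))

    count-availExc : ∀ t → ExcSuffixInv t → ∑ n ([_] ∘ availExc t) + ∑> m (m ∸ t) excStep ≡ ∑≥ m (m ∸ t) (λ i → [ not (isUorL₀ (s i)) ])
    count-availExc t (sub , cnt) = trans (cong (∑ n ([_] ∘ availExc t) +_) (sym cnt))
      (trans (sym (∑-+ n _ _)) (trans (∑-cong n (λ u _ → avail-or-used u)) (count-excPool t)))
      where
      avail-or-used : ∀ u → [ availExc t u ] + [ usedExc t u ] ≡ [ excPool t u ]
      avail-or-used u with usedExc t u in eu
      ... | false rewrite ∧-identityʳ (not (weakValue u)) = +-identityʳ _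
      ... | true rewrite <ᵇ-true (proj₁ (sub u eu)) | proj₂ (sub u eu) = refl

    excPos-true : ∀ q → excPos q ≡ true → q < m × isUorL₁ (s q) ≡ true
    excPos-true q e with q <ᵇ m | <ᵇ-reflects-< q m | e
    ... | true | ofʸ lt | e′ = lt , e′

    -- The requested rank (counted from the top) is smaller than the number of candidates:
    -- the path descends from height ≥ r q back to 0 after q.
    weight<availableExc : ∀ t → ExcSuffixInv t → excPos (m ∸ t) ≡ true → suc (r (m ∸ t)) ≤ rank (availExc t) n
    weight<availableExc t suffixInv ex = +-cancelʳ-≤ (∑> m q excStep) _ _ (subst (suc (r q) + ∑> m q excStep ≤_) (sym (count-availExc t suffixInv)) main)
      where
      q = m ∸ t
      q<m = proj₁ (excPos-true q ex)
      NG = λ i → [ not (isUorL₀ (s i)) ]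
      SU = ∑≥ m q (isUn ∘ s)
      SD = ∑≥ m q (isDn ∘ s)
      total : ∑ q (isUn ∘ s) + SU ≡ ∑ q (isDn ∘ s) + SD
      total = trans (sym (∑-prefix-suffix m q (isUn ∘ s) (<⇒≤ q<m))) (trans V2 (∑-prefix-suffix m q (isDn ∘ s) (<⇒≤ q<m)))
      descent : r q + SU ≤ SD
      descent = +-cancelˡ-≤ (∑ q (isDn ∘ s)) _ _ (begin
        ∑ q (isDn ∘ s) + (r q + SU) ≡⟨ regroup₃ (∑ q (isDn ∘ s)) (r q) SU ⟩
        r q + ∑ q (isDn ∘ s) + SU   ≤⟨ +-monoˡ-≤ SU (V1 q q<m) ⟩
        ∑ q (isUn ∘ s) + SU         ≡⟨ total ⟩
        ∑ q (isDn ∘ s) + SD ∎)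
        where
        open ≤-Reasoning
        regroup₃ : ∀ (a b c : ℕ) → a + (b + c) ≡ b + a + c
        regroup₃ = solve-∀
      excs-from-q : ∑≥ m q excStep ≡ ∑> m q excStep + 1
      excs-from-q = trans (∑≥-unfold m q excStep q<m) (cong (∑> m q excStep +_) (cong [_] (proj₂ (excPos-true q ex))))
      main : suc (r q) + ∑> m q excStep ≤ ∑≥ m q NG
      main = +-cancelʳ-≤ SU _ _ (begin
        suc (r q) + ∑> m q excStep + SU       ≡⟨ regroup₄ (r q) (∑> m q excStep) SU ⟩
        (r q + SU) + (∑> m q excStep + 1)     ≤⟨ +-monoˡ-≤ (∑> m q excStep + 1) descent ⟩
        SD + (∑> m q excStep + 1)             ≡⟨ cong (SD +_) (sym excs-from-q) ⟩
        SD + ∑≥ m q excStep                   ≡⟨ sym (suffix-balance q) ⟩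
        ∑≥ m q NG + SU ∎)
        where
        open ≤-Reasoning
        regroup₄ : ∀ (a b c : ℕ) → suc a + b + c ≡ (a + c) + (b + 1)
        regroup₄ = solve-∀

    pickExc-spec : ∀ t → ExcSuffixInv t → excPos (m ∸ t) ≡ true →
      pickExc t < n × availExc t (pickExc t) ≡ true × rank (availExc t) (pickExc t) ≡ rank (availExc t) n ∸ suc (r (m ∸ t))
    pickExc-spec t suffixInv ex = select-spec n (availExc t) _ (∸-monoʳ-< z<s (weight<availableExc t suffixInv ex))

    excSuffixInv-suc : ∀ t → t < m → ExcSuffixInv t → ExcSuffixInv (suc t)
    excSuffixInv-suc t t<m (sub , cnt) = step (excPos (m ∸ t)) refl
      where
      q = m ∸ t
      q′ = m ∸ suc t
      q≡1+q′ : q ≡ suc q′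
      q≡1+q′ = +-∸-assoc 1 t<m
      q′≤q : q′ ≤ q
      q′≤q = subst (q′ ≤_) (sym q≡1+q′) (n≤1+n q′)
      excs-after-q′ : ∑> m q′ excStep ≡ ∑> m q excStep + [ excPos q ]
      excs-after-q′ = trans (∑>-unfold m q′ excStep)
        (subst (λ z → ∑> m (suc q′) excStep + (suc q′ <ᵇ m) ?· excStep (suc q′) ≡ ∑> m z excStep + [ (z <ᵇ m) ∧ isUorL₁ (s z) ]) (sym q≡1+q′)
          (cong (∑> m (suc q′) excStep +_) (sym ([∧] (suc q′ <ᵇ m) (isUorL₁ (s (suc q′)))))))
      step : ∀ b → excPos q ≡ b → ExcSuffixInv (suc t)
      step false ex = sub′ , cnt′
        where
        unchanged : ∀ u → usedExc (suc t) u ≡ usedExc t u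
        unchanged u = trans (cong (λ c → usedExc t u ∨ (c ∧ (pickExc t ≡ᵇ u))) ex) (∨-identityʳ _)
        sub′ : ∀ u → usedExc (suc t) u ≡ true → q′ < u × weakValue u ≡ false
        sub′ u e = let (a , b) = sub u (trans (sym (unchanged u)) e) in ≤-<-trans q′≤q a , b
        cnt′ : ∑ n ([_] ∘ usedExc (suc t)) ≡ ∑> m q′ excStep
        cnt′ = trans (∑-cong n (λ u _ → cong [_] (unchanged u)))
          (trans cnt (sym (trans excs-after-q′ (trans (cong (λ c → ∑> m q excStep + [ c ]) ex) (+-identityʳ _)))))
      step true ex = sub′ , cnt′
        where
        sp = pickExc-spec t (sub , cnt) ex
        k = pickExc t
        k-parts = availExc-parts t k (proj₁ (proj₂ sp))
        sub′ : ∀ u → usedExc (suc t) u ≡ true → q′ < u × weakValue u ≡ false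
        sub′ u e with usedExc t u in eu
        ... | true = ≤-<-trans q′≤q (proj₁ (sub u eu)) , proj₂ (sub u eu)
        ... | false with k ≡ᵇ u | ≡ᵇ-reflects k u | trans (sym (cong (λ c → false ∨ (c ∧ (k ≡ᵇ u))) ex)) e
        ...   | true | ofʸ refl | _ = ≤-<-trans q′≤q (proj₁ k-parts) , proj₁ (proj₂ k-parts)
        cnt′ : ∑ n ([_] ∘ usedExc (suc t)) ≡ ∑> m q′ excStep
        cnt′ = begin
          ∑ n ([_] ∘ usedExc (suc t))            ≡⟨ ∑-cong n (λ u _ → cong [_] (cong (λ c → usedExc t u ∨ (c ∧ (k ≡ᵇ u))) ex)) ⟩
          ∑ n (λ u → [ usedExc t u ∨ (k ≡ᵇ u) ]) ≡⟨ ∑-insert n (usedExc t) k (proj₁ sp) (proj₂ (proj₂ k-parts)) ⟩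
          ∑ n ([_] ∘ usedExc t) + 1              ≡⟨ cong₂ _+_ cnt (cong [_] (sym ex)) ⟩
          ∑> m q excStep + [ excPos q ]          ≡⟨ sym excs-after-q′ ⟩
          ∑> m q′ excStep ∎
          where open ≡-Reasoning

    excSuffixInv-all : ∀ t → t ≤ m → ExcSuffixInv t
    excSuffixInv-all zero _ = excSuffixInv-zero
    excSuffixInv-all (suc t) st≤m = excSuffixInv-suc t st≤m (excSuffixInv-all t (≤-trans (n≤1+n t) st≤m))

    usedWeak-mono : ∀ p d u → usedWeak p u ≡ true → usedWeak (d + p) u ≡ true
    usedWeak-mono p zero u e = e
    usedWeak-mono p (suc d) u e = cong (_∨ (not (excPos (d + p)) ∧ (pickWeak (d + p) ≡ᵇ u))) (usedWeak-mono p d u e)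

    usedExc-mono : ∀ t d u → usedExc t u ≡ true → usedExc (d + t) u ≡ true
    usedExc-mono t zero u e = e
    usedExc-mono t (suc d) u e = cong (_∨ (excPos (m ∸ (d + t)) ∧ (pickExc (d + t) ≡ᵇ u))) (usedExc-mono t d u e)

    pickWeak-facts : ∀ p → p < n → excPos p ≡ false → pickWeak p < n × pickWeak p ≤ p × weakValue (pickWeak p) ≡ true × usedWeak p (pickWeak p) ≡ false
    pickWeak-facts p p<n ex =
      let (k<n , avail , _) = pickWeak-spec p p<n (weakPrefixInv-all p (<⇒≤ p<n))
          (k≤p , weak , fresh) = availWeak-parts p (pickWeak p) avail
      in k<n , ≤-pred k≤p , weak , fresh

    pickExc-facts : ∀ p → p < n → excPos p ≡ true → pickExc (m ∸ p) < n × p < pickExc (m ∸ p) × weakValue (pickExc (m ∸ p)) ≡ false × usedExc (m ∸ p) (pickExc (m ∸ p)) ≡ false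
    pickExc-facts p p<n ex =
      let (k<n , avail , _) = pickExc-spec t (excSuffixInv-all t (m∸n≤m m p)) (trans (cong excPos m∸t≡p) ex)
          (q<k , weak , fresh) = availExc-parts t (pickExc t) avail
      in k<n , subst (_< pickExc t) m∸t≡p q<k , weak , fresh
      where
      t = m ∸ p
      m∸t≡p : m ∸ t ≡ p
      m∸t≡p = m∸[m∸n]≡n (≤-pred p<n)

    decode<n : ∀ p → p < n → decode p < n
    decode<n p p<n with excPos p in ex
    ... | true = proj₁ (pickExc-facts p p<n ex)
    ... | false = proj₁ (pickWeak-facts p p<n ex)

    weak-picks-distinct : ∀ p1 p2 → p1 < p2 → p2 < n → excPos p1 ≡ false → excPos p2 ≡ false → pickWeak p1 ≢ pickWeak p2
    weak-picks-distinct p1 p2 p1<p2 p2<n e1 e2 eq = contradiction (trans (sym fresh) used) (λ ())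
      where
      fresh = proj₂ (proj₂ (proj₂ (pickWeak-facts p2 p2<n e2)))
      used-next : usedWeak (suc p1) (pickWeak p1) ≡ true
      used-next = trans (cong (λ c → usedWeak p1 (pickWeak p1) ∨ (not c ∧ (pickWeak p1 ≡ᵇ pickWeak p1))) e1)
        (trans (cong (usedWeak p1 (pickWeak p1) ∨_) (≡ᵇ-self (pickWeak p1))) (∨-zeroʳ _))
      used : usedWeak p2 (pickWeak p2) ≡ true
      used = subst (λ z → usedWeak z (pickWeak p2) ≡ true) (m∸n+n≡m p1<p2)
        (usedWeak-mono (suc p1) (p2 ∸ suc p1) (pickWeak p2) (subst (λ z → usedWeak (suc p1) z ≡ true) eq used-next))

    exc-picks-distinct : ∀ p1 p2 → p1 < p2 → p2 < n → excPos p1 ≡ true → excPos p2 ≡ true → pickExc (m ∸ p1) ≢ pickExc (m ∸ p2)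
    exc-picks-distinct p1 p2 p1<p2 p2<n e1 e2 eq = contradiction (trans (sym fresh) used) (λ ())
      where
      t1 = m ∸ p1
      t2 = m ∸ p2
      fresh = proj₂ (proj₂ (proj₂ (pickExc-facts p1 (<-trans p1<p2 p2<n) e1)))
      used-next : usedExc (suc t2) (pickExc t2) ≡ true
      used-next = trans (cong (λ c → usedExc t2 (pickExc t2) ∨ (c ∧ (pickExc t2 ≡ᵇ pickExc t2))) (trans (cong excPos (m∸[m∸n]≡n (≤-pred p2<n))) e2))
        (trans (cong (usedExc t2 (pickExc t2) ∨_) (≡ᵇ-self (pickExc t2))) (∨-zeroʳ _))
      t2<t1 : suc t2 ≤ t1
      t2<t1 = ∸-monoʳ-< p1<p2 (≤-pred p2<n)
      used : usedExc t1 (pickExc t1) ≡ true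
      used = subst (λ z → usedExc z (pickExc t1) ≡ true) (m∸n+n≡m t2<t1)
        (usedExc-mono (suc t2) (t1 ∸ suc t2) (pickExc t1) (subst (λ z → usedExc (suc t2) z ≡ true) (sym eq) used-next))

    -- Weak and non-weak values never coincide, and each phase uses a value once.
    decode-distinct : ∀ a b → a < b → b < n → decode a ≢ decode b
    decode-distinct a b a<b b<n with excPos a in ea | excPos b in eb
    ... | false | false = weak-picks-distinct a b a<b b<n ea eb
    ... | true | true = exc-picks-distinct a b a<b b<n ea eb
    ... | false | true = λ e → contradiction (trans (sym (proj₁ (proj₂ (proj₂ (pickWeak-facts a (<-trans a<b b<n) ea)))))
                                 (trans (cong weakValue e) (proj₁ (proj₂ (proj₂ (pickExc-facts b b<n eb)))))) (λ ())
    ... | true | false = λ e → contradiction (trans (sym (proj₁ (proj₂ (proj₂ (pickExc-facts a (<-trans a<b b<n) ea)))))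
                                 (trans (cong weakValue e) (proj₁ (proj₂ (proj₂ (pickWeak-facts b b<n eb)))))) (λ ())

    decode-injective : ∀ p1 p2 → p1 < n → p2 < n → decode p1 ≡ decode p2 → p1 ≡ p2
    decode-injective p1 p2 p1<n p2<n eq with <-cmp p1 p2
    ... | tri≈ _ e _ = e
    ... | tri< lt _ _ = contradiction eq (decode-distinct p1 p2 lt p2<n)
    ... | tri> _ _ gt = contradiction (sym eq) (decode-distinct p2 p1 gt p1<n)


module FinInjections where

  open import Data.Nat using (suc)
  open import Data.Nat.Properties using (n≮n)
  open import Data.Fin using (Fin; punchOut)
  open import Data.Fin.Properties using (any?; punchOut-injective; injective⇒≤; _≟_)
  open import Data.Fin.Permutation using (Permutation′; _⟨$⟩ʳ_; permutation)
  open import Relation.Nullary using (yes; no)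
  open import Relation.Nullary.Negation using (contradiction)
  open import Relation.Binary.PropositionalEquality
  open import Data.Product using (Σ; _,_; proj₁; proj₂; ∃)

  -- If v were missed, φ would inject Fin (1 + k) into Fin k.
  injective⇒surjective : ∀ {n} (φ : Fin n → Fin n) → (∀ {a b} → φ a ≡ φ b → a ≡ b) → ∀ v → ∃ λ u → φ u ≡ v
  injective⇒surjective {suc k} φ inj v with any? (λ u → φ u ≟ v)
  ... | yes hit = hit
  ... | no miss = contradiction (injective⇒≤ {f = ψ} ψ-inj) (n≮n k)
    where
    ψ : Fin (suc k) → Fin k
    ψ u = punchOut {i = v} {j = φ u} (λ e → miss (u , sym e))
    ψ-inj : ∀ {a b} → ψ a ≡ ψ b → a ≡ b
    ψ-inj {a} {b} e = inj (punchOut-injective (λ e → miss (a , sym e)) (λ e → miss (b , sym e)) e)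

  injection→permutation : ∀ {n} (φ : Fin n → Fin n) → (∀ {a b} → φ a ≡ φ b → a ≡ b) → Σ (Permutation′ n) (λ π → ∀ i → π ⟨$⟩ʳ i ≡ φ i)
  injection→permutation φ inj =
    permutation φ φ⁻¹ (λ y → proj₂ (injective⇒surjective φ inj y)) (λ x → inj (proj₂ (injective⇒surjective φ inj (φ x)))) , λ i → refl
    where
    φ⁻¹ = λ v → proj₁ (injective⇒surjective φ inj v)


module RightInverse where

  open FiniteSums
  open NatPermutations
  open Selection
  open Encoding using (module Code; mkStep)
  open Decoding
  open DecoderValidity
  open FinInjections
  open import Defs using (Step; isUorL₁; [_])
  open import Data.Nat using (ℕ; zero; suc; _+_; _∸_; _≤_; _<_; s≤s; _<ᵇ_)
  open import Data.Nat.Properties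
  open import Data.Bool using (true; false; if_then_else_; _∧_; not)
  open import Data.Fin using (Fin; toℕ; fromℕ<)
  open import Data.Fin.Properties using (toℕ<n; toℕ-fromℕ<; toℕ-injective)
  open import Data.Fin.Permutation using (Permutation′; _⟨$⟩ʳ_)
  open import Relation.Binary.PropositionalEquality hiding ([_])
  open import Function using (_∘_)
  open import Data.Product using (proj₁; proj₂)

  module DecodeHistory (m : ℕ) (s : ℕ → Step) (r : ℕ → ℕ)
    (V1 : ∀ p → p < m → r p + ∑ p (isDn ∘ s) ≤ ∑ p (isUn ∘ s))
    (V2 : ∑ m (isUn ∘ s) ≡ ∑ m (isDn ∘ s)) where
    open Decoder m s r
    open Valid m s r V1 V2

    φ : Fin n → Fin n
    φ i = fromℕ< (decode<n (toℕ i) (toℕ<n i))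

    φ-inj : ∀ {a b} → φ a ≡ φ b → a ≡ b
    φ-inj {a} {b} e = toℕ-injective (decode-injective (toℕ a) (toℕ b) (toℕ<n a) (toℕ<n b)
      (trans (sym (toℕ-fromℕ< _)) (trans (cong toℕ e) (toℕ-fromℕ< _))))

    π : Permutation′ n
    π = proj₁ (injection→permutation φ φ-inj)

    P : PermN n
    P = toPermN π

    open PermN P
    open Code P hiding (n)
    open Agreement m s r P

    σ≡decode : ∀ j → j < n → f j ≡ decode j
    σ≡decode j j<n = trans (ext-fromℕ< (π ⟨$⟩ʳ_) j j<n)
      (trans (cong toℕ (proj₂ (injection→permutation φ φ-inj) (fromℕ< j<n)))
      (trans (toℕ-fromℕ< _) (cong decode (toℕ-fromℕ< j<n))))

    decode-exc : ∀ p → excPos p ≡ true → decode p ≡ pickExc (m ∸ p)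
    decode-exc p e = cong (λ c → if c then pickExc (m ∸ p) else pickWeak p) e

    decode-weak : ∀ p → excPos p ≡ false → decode p ≡ pickWeak p
    decode-weak p e = cong (λ c → if c then pickExc (m ∸ p) else pickWeak p) e

    excPos≡excᵇ : ∀ p → p < n → excPos p ≡ excᵇ p
    excPos≡excᵇ p p<n with excPos p in ex
    ... | true = sym (<ᵇ-true (subst (p <_) (sym (trans (σ≡decode p p<n) (decode-exc p ex))) (proj₁ (proj₂ (pickExc-facts p p<n ex)))))
    ... | false = sym (<ᵇ-false (≤⇒≯ (subst (_≤ p) (sym (trans (σ≡decode p p<n) (decode-weak p ex))) (proj₁ (proj₂ (pickWeak-facts p p<n ex))))))

    weakValue≡ : ∀ u → u < n → weakValue u ≡ not (g u <ᵇ u)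
    weakValue≡ u u<n with excPos (g u) in ex
    ... | true = trans (cong weakValue (sym picked)) (trans (proj₁ (proj₂ (proj₂ facts)))
                   (cong not (sym (<ᵇ-true (subst (q <_) picked (proj₁ (proj₂ facts)))))))
      where
      q = g u
      facts = pickExc-facts q (g< u u<n) ex
      picked : pickExc (m ∸ q) ≡ u
      picked = trans (sym (decode-exc q ex)) (trans (sym (σ≡decode q (g< u u<n))) (fg u u<n))
    ... | false = trans (cong weakValue (sym picked)) (trans (proj₁ (proj₂ (proj₂ facts)))
                   (cong not (sym (<ᵇ-false (≤⇒≯ (subst (_≤ q) picked (proj₁ (proj₂ facts))))))))
      where
      q = g u
      facts = pickWeak-facts q (g< u u<n) ex
      picked : pickWeak q ≡ u
      picked = trans (sym (decode-weak q ex)) (trans (sym (σ≡decode q (g< u u<n))) (fg u u<n))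

    open Consistent excPos≡excᵇ weakValue≡

    usedWeakInv-all : ∀ p → p ≤ n → UsedWeakInv p
    usedWeakInv-all zero _ = usedWeakInv-zero
    usedWeakInv-all (suc p) sp≤n = usedWeakInv-suc p sp≤n (usedWeakInv-all p (≤-trans (n≤1+n p) sp≤n))
      (λ ex → sym (trans (σ≡decode p sp≤n) (decode-weak p (trans (excPos≡excᵇ p sp≤n) ex))))

    usedExcInv-all : ∀ t → t ≤ m → UsedExcInv t
    usedExcInv-all zero _ = usedExcInv-zero
    usedExcInv-all (suc t) st≤m = usedExcInv-suc t t≤m (usedExcInv-all t t≤m)
      (λ ex → sym (trans (σ≡decode q q<n) (trans (decode-exc q (trans (excPos≡excᵇ q q<n) ex)) (cong pickExc (m∸[m∸n]≡n t≤m)))))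
      where
      t≤m = ≤-trans (n≤1+n t) st≤m
      q = m ∸ t
      q<n : q < n
      q<n = s≤s (m∸n≤m m t)

    code-step : ∀ p → p < m → step p ≡ s p
    code-step p p<m = trans (cong₂ mkStep exc-bit weak-bit) (mkStep-bits (s p))
      where
      exc-bit : excᵇ p ≡ isUorL₁ (s p)
      exc-bit = trans (sym (excPos≡excᵇ p (m<n⇒m<1+n p<m))) (cong (_∧ isUorL₁ (s p)) (<ᵇ-true p<m))
      weak-bit : weakᵇ p ≡ isUorL₀ (s p)
      weak-bit = trans (weakᵇ≡ p) (sym (weakValue≡ (suc p) (s≤s p<m)))

    code-weight-weak : ∀ p → p < m → excPos p ≡ false → μ p ≡ r p
    code-weight-weak p p<m ex = begin
      μ p                       ≡⟨ sym (proj₂ (rank-weak p p<n (trans (sym (excPos≡excᵇ p p<n)) ex))) ⟩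
      rank (freeBelow p) (f p)  ≡⟨ ∑-cong (f p) (λ u u<fp → cong [_] (sym (availWeak-correct p (usedWeakInv-all p (<⇒≤ p<n)) u (<-trans u<fp (f< p p<n))))) ⟩
      rank (availWeak p) (f p)  ≡⟨ cong (rank (availWeak p)) (trans (σ≡decode p p<n) (decode-weak p ex)) ⟩
      rank (availWeak p) (pickWeak p) ≡⟨ proj₂ (proj₂ (pickWeak-spec p p<n (weakPrefixInv-all p (<⇒≤ p<n)))) ⟩
      weight′ p                 ≡⟨ cong (λ c → if c then r p else 0) (<ᵇ-true p<m) ⟩
      r p ∎
      where
      open ≡-Reasoning
      p<n = m<n⇒m<1+n p<m

    code-weight-exc : ∀ p → p < m → excPos p ≡ true → μ p ≡ r p
    code-weight-exc p p<m ex = suc-injective (+-cancelˡ-≡ below _ _ (trans (proj₂ (rank-exc p p<n exb)) (sym total)))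
      where
      p<n = m<n⇒m<1+n p<m
      exb : excᵇ p ≡ true
      exb = trans (sym (excPos≡excᵇ p p<n)) ex
      t = m ∸ p
      t≤m = m∸n≤m m p
      m∸t≡p : m ∸ t ≡ p
      m∸t≡p = m∸[m∸n]≡n (<⇒≤ p<m)
      ex′ : excPos (m ∸ t) ≡ true
      ex′ = trans (cong excPos m∸t≡p) ex
      same-candidates : ∀ u → u < n → availExc t u ≡ freeAbove p u
      same-candidates u u<n = trans (availExc-correct t t≤m (usedExcInv-all t t≤m) u u<n) (cong (λ z → freeAbove z u) m∸t≡p)
      below = rank (freeAbove p) (f p)
      candidates = rank (freeAbove p) n
      candidates≡ : rank (availExc t) n ≡ candidates
      candidates≡ = ∑-cong n (λ u u<n → cong [_] (same-candidates u u<n))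
      below≡ : below ≡ candidates ∸ suc (r p)
      below≡ = begin
        below                                   ≡⟨ ∑-cong (f p) (λ u u<fp → cong [_] (sym (same-candidates u (<-trans u<fp (f< p p<n))))) ⟩
        rank (availExc t) (f p)                 ≡⟨ cong (rank (availExc t)) (trans (σ≡decode p p<n) (decode-exc p ex)) ⟩
        rank (availExc t) (pickExc t)           ≡⟨ proj₂ (proj₂ (pickExc-spec t (excSuffixInv-all t t≤m) ex′)) ⟩
        rank (availExc t) n ∸ suc (r (m ∸ t))   ≡⟨ cong₂ (λ a z → a ∸ suc (r z)) candidates≡ m∸t≡p ⟩
        candidates ∸ suc (r p) ∎
        where open ≡-Reasoning
      r<candidates : suc (r p) ≤ candidates
      r<candidates = subst₂ (λ a z → suc (r z) ≤ a) candidates≡ m∸t≡p (weight<availableExc t (excSuffixInv-all t t≤m) ex′)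
      total : below + suc (r p) ≡ candidates
      total = trans (cong (_+ suc (r p)) below≡) (m∸n+n≡m r<candidates)

    code-weight : ∀ p → p < m → μ p ≡ r p
    code-weight p p<m with excPos p in ex
    ... | false = code-weight-weak p p<m ex
    ... | true = code-weight-exc p p<m ex


module HistoriesAsFunctions where

  open FiniteSums
  open DecoderValidity using (isUn; isDn)
  open import Defs using (Step; U; D; L₀; L₁; stepHeight; netHeight)
  open import Data.Nat using (ℕ; zero; suc; _≤_; _<_; s≤s; _<?_)
  import Data.Nat as ℕ
  open import Data.Integer using (ℤ; +_; 0ℤ; _+_)
  import Data.Integer.Properties as ℤ
  open import Algebra.Properties.CommutativeSemigroup ℤ.+-commutativeSemigroup using (interchange)
  open import Data.Fin using (Fin; toℕ; fromℕ<) renaming (zero to fz; suc to fs)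
  open import Data.Fin.Properties using (toℕ<n; toℕ-fromℕ<; fromℕ<-toℕ)
  open import Data.Vec using (Vec; tabulate; toList; lookup)
  open import Data.Vec.Properties using (lookup∘tabulate)
  open import Data.List using (take; foldr)
  import Data.List as List
  open import Data.Nat.ListAction using (sum)
  open import Relation.Nullary using (yes; no)
  open import Relation.Nullary.Negation using (contradiction)
  open import Relation.Binary.PropositionalEquality
  open import Function using (_∘_)

  vget : ∀ {A : Set} {m} → A → Vec A m → ℕ → A
  vget {m = m} d w p with p <? m
  ... | yes q = lookup w (fromℕ< q)
  ... | no _ = d

  vget-lookup : ∀ {A : Set} {m} (d : A) (w : Vec A m) (i : Fin m) → vget d w (toℕ i) ≡ lookup w i
  vget-lookup {m = m} d w i with toℕ i <? m
  ... | yes q = cong (lookup w) (fromℕ<-toℕ i q)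
  ... | no ¬q = contradiction (toℕ<n i) ¬q

  vget-tabulate : ∀ {A : Set} {m} (d : A) (F : ℕ → A) p → p < m → vget d (tabulate {n = m} (F ∘ toℕ)) p ≡ F p
  vget-tabulate {m = m} d F p p<m with p <? m
  ... | yes q = trans (lookup∘tabulate (F ∘ toℕ) (fromℕ< q)) (cong F (toℕ-fromℕ< q))
  ... | no ¬q = contradiction p<m ¬q

  foldr-tabulate≡∑ : ∀ k (h : Fin k → ℤ) (h' : ℕ → ℕ) → (∀ i → h i ≡ + h' (toℕ i)) → foldr _+_ 0ℤ (List.tabulate h) ≡ + ∑ k h'
  foldr-tabulate≡∑ zero h h' e = refl
  foldr-tabulate≡∑ (suc k) h h' e = trans (cong₂ _+_ (e fz) (foldr-tabulate≡∑ k (h ∘ fs) (h' ∘ suc) (λ i → e (fs i))))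
    (trans (sym (ℤ.pos-+ (h' 0) _)) (cong +_ (sym (∑-unfoldˡ k h'))))

  sum-toList-tabulate≡∑ : ∀ k (F : ℕ → ℕ) → sum (toList (tabulate {n = k} (F ∘ toℕ))) ≡ ∑ k F
  sum-toList-tabulate≡∑ zero F = refl
  sum-toList-tabulate≡∑ (suc k) F = trans (cong (F 0 ℕ.+_) (sum-toList-tabulate≡∑ k (F ∘ suc))) (sym (∑-unfoldˡ k F))

  stepHeight+isDn : ∀ x → stepHeight x + + isDn x ≡ + isUn x
  stepHeight+isDn U = refl
  stepHeight+isDn D = refl
  stepHeight+isDn L₀ = refl
  stepHeight+isDn L₁ = refl

  netHeight-count : ∀ m (s : ℕ → Step) k → k ≤ m →
    netHeight (take k (toList (tabulate {n = m} (s ∘ toℕ)))) + + ∑ k (isDn ∘ s) ≡ + ∑ k (isUn ∘ s)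
  netHeight-count m s zero _ = refl
  netHeight-count (suc m) s (suc k) (s≤s k≤m) = begin
    stepHeight (s 0) + h + + ∑ (suc k) (isDn ∘ s)
      ≡⟨ cong (λ z → stepHeight (s 0) + h + z) (trans (cong +_ (∑-unfoldˡ k (isDn ∘ s))) (ℤ.pos-+ (isDn (s 0)) _)) ⟩
    stepHeight (s 0) + h + (+ isDn (s 0) + + ∑ k (isDn ∘ s ∘ suc))
      ≡⟨ interchange (stepHeight (s 0)) h (+ isDn (s 0)) (+ ∑ k (isDn ∘ s ∘ suc)) ⟩
    (stepHeight (s 0) + + isDn (s 0)) + (h + + ∑ k (isDn ∘ s ∘ suc))
      ≡⟨ cong₂ _+_ (stepHeight+isDn (s 0)) (netHeight-count m (s ∘ suc) k k≤m) ⟩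
    + isUn (s 0) + + ∑ k (isUn ∘ s ∘ suc)
      ≡⟨ trans (sym (ℤ.pos-+ (isUn (s 0)) _)) (cong +_ (sym (∑-unfoldˡ k (isUn ∘ s)))) ⟩
    + ∑ (suc k) (isUn ∘ s) ∎
    where
    open ≡-Reasoning
    h = netHeight (take k (toList (tabulate {n = m} (s ∘ suc ∘ toℕ))))


module Bijection where

  open FiniteSums
  open NatPermutations
  open Encoding using (module Code; mkStep)
  open Decoding
  open LeftInverse using (module DecodeCode)
  open DecoderValidity using (isUn; isDn)
  open RightInverse using (module DecodeHistory)
  open HistoriesAsFunctions
  open import Defs
  open import Data.Nat using (ℕ; suc; _≤_; _<_; z≤n; _<ᵇ_)
  import Data.Nat as ℕ
  open import Data.Nat.Properties using (≤-refl; ≤-reflexive; <⇒≤; m<n⇒m<1+n; ≤-pred; +-cancelʳ-≡; +-comm; +-assoc; <⇒≱)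
  open import Data.Integer using (ℤ; +_; 0ℤ; +≤+; _-_; _+_)
  import Data.Integer as ℤ
  import Data.Integer.Properties as ℤ
  open import Algebra.Properties.AbelianGroup ℤ.+-0-abelianGroup using (∙-cancelʳ)
  open import Data.Integer.Tactic.RingSolver using (solve-∀)
  open import Data.Fin using (Fin; toℕ; fromℕ<; inject₁; fromℕ)
  open import Data.Fin.Properties using (toℕ<n; toℕ-fromℕ<; toℕ-injective; toℕ-inject₁; toℕ-fromℕ)
  open import Data.Fin.Permutation using (Permutation′; _⟨$⟩ʳ_)
  open import Data.Vec using (Vec; tabulate; toList; lookup)
  open import Data.Vec.Properties using (lookup∘tabulate; tabulate∘lookup; tabulate-cong; length-toList)
  open import Data.List using (take; foldr)
  open import Data.List.Properties using (take-all; map-tabulate)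
  open import Data.Bool using (true; false; _∧_)
  open import Relation.Binary.PropositionalEquality hiding ([_])
  open import Function using (_∘_)
  open import Data.Product using (Σ; _×_; _,_; proj₂)

  -- One up step per excedance and per weak value, one down step per position.
  isUn+1 : ∀ a b → isUn (mkStep a b) ℕ.+ 1 ≡ [ a ] ℕ.+ [ b ] ℕ.+ isDn (mkStep a b)
  isUn+1 true true = refl
  isUn+1 true false = refl
  isUn+1 false true = refl
  isUn+1 false false = refl

  module CodeOf {m : ℕ} (σ : Permutation′ (suc m)) where
    open PermN (toPermN σ)
    open Code (toPermN σ)

    path : Vec Step m
    path = tabulate (step ∘ toℕ)

    weights : Vec ℕ m
    weights = tabulate (μ ∘ toℕ)

    ups≡cross+downs : ∀ k → k ≤ m → ∑ k (isUn ∘ step) ≡ cross k ℕ.+ ∑ k (isDn ∘ step)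
    ups≡cross+downs k k≤m = +-cancelʳ-≡ k _ _ (begin
      ∑ k (isUn ∘ step) ℕ.+ k                                      ≡⟨ trans (cong (∑ k (isUn ∘ step) ℕ.+_) (sym (∑-one k))) (sym (∑-+ k _ _)) ⟩
      ∑ k (λ i → isUn (step i) ℕ.+ 1)                             ≡⟨ ∑-cong k (λ i _ → isUn+1 (excᵇ i) (weakᵇ i)) ⟩
      ∑ k (λ i → [ excᵇ i ] ℕ.+ [ weakᵇ i ] ℕ.+ isDn (step i))    ≡⟨ trans (∑-+ k _ _) (cong (ℕ._+ ∑ k (isDn ∘ step)) (∑-+ k _ _)) ⟩
      ∑ k ([_] ∘ excᵇ) ℕ.+ ∑ k ([_] ∘ weakᵇ) ℕ.+ ∑ k (isDn ∘ step) ≡⟨ cong (ℕ._+ ∑ k (isDn ∘ step)) (cross-formula k k≤m) ⟩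
      k ℕ.+ cross k ℕ.+ ∑ k (isDn ∘ step)                          ≡⟨ trans (+-assoc k (cross k) _) (+-comm k _) ⟩
      cross k ℕ.+ ∑ k (isDn ∘ step) ℕ.+ k ∎)
      where open ≡-Reasoning

    height≡cross : ∀ k → k ≤ m → netHeight (take k (toList path)) ≡ + cross k
    height≡cross k k≤m = ∙-cancelʳ (+ ∑ k (isDn ∘ step)) _ _
      (trans (netHeight-count m step k k≤m) (trans (cong +_ (ups≡cross+downs k k≤m)) (ℤ.pos-+ (cross k) _)))

    motzkin : IsMotzkin path
    motzkin = (λ k → subst (0ℤ ℤ.≤_) (sym (height≡cross (toℕ k) (≤-pred (toℕ<n k)))) (+≤+ z≤n))
            , trans (cong netHeight (sym (take-all m (toList path) (≤-reflexive (length-toList path)))))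
                    (trans (height≡cross m ≤-refl) (cong +_ cross-last))

    bounded : ∀ (i : Fin m) → + lookup weights i ℤ.≤ height path i
    bounded i = subst₂ ℤ._≤_ (cong +_ (sym (lookup∘tabulate (μ ∘ toℕ) i))) (sym (height≡cross (toℕ i) (<⇒≤ (toℕ<n i))))
      (+≤+ (μ≤cross (toℕ i) (m<n⇒m<1+n (toℕ<n i))))

    history : Laguerre m
    history = laguerre path weights motzkin bounded

  Φ : ∀ {m} → Permutation′ (suc m) → Laguerre m
  Φ σ = CodeOf.history σ

  -- Decoding Φ σ recovers σ.
  Φ-injective : ∀ m (σ τ : Permutation′ (suc m)) → Laguerre.path (Φ σ) ≡ Laguerre.path (Φ τ)
    → Laguerre.weights (Φ σ) ≡ Laguerre.weights (Φ τ) → ∀ i → σ ⟨$⟩ʳ i ≡ τ ⟨$⟩ʳ i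
  Φ-injective m σ τ same-path same-weights i =
    toℕ-injective (trans (sym (decode-Φ σ)) (trans (cong₂ (λ w μ → decode-history w μ (toℕ i)) same-path same-weights) (decode-Φ τ)))
    where
    decode-history : Vec Step m → Vec ℕ m → ℕ → ℕ
    decode-history w μ = Decoder.decode m (vget L₀ w) (vget 0 μ)
    decode-Φ : ∀ ρ → decode-history (Laguerre.path (Φ ρ)) (Laguerre.weights (Φ ρ)) (toℕ i) ≡ toℕ (ρ ⟨$⟩ʳ i)
    decode-Φ ρ = trans (DecodeCode.decode-code m (toPermN ρ) _ _ (vget-tabulate L₀ (Code.step (toPermN ρ))) (vget-tabulate 0 (Code.μ (toPermN ρ)))
      (toℕ i) (toℕ<n i)) (ext-toℕ (ρ ⟨$⟩ʳ_) i)

  -- A Laguerre history is valid input for the decoder, and Φ of the result is the history.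
  Φ-surjective : ∀ m (h : Laguerre m) → Σ (Permutation′ (suc m)) λ σ →
    Laguerre.path (Φ σ) ≡ Laguerre.path h × Laguerre.weights (Φ σ) ≡ Laguerre.weights h
  Φ-surjective m (laguerre w μv mot bd) = π , same-path , same-weights
    where
    s = vget L₀ w
    r = vget 0 μv
    w≡tabulate : w ≡ tabulate (s ∘ toℕ)
    w≡tabulate = trans (sym (tabulate∘lookup w)) (tabulate-cong (λ i → sym (vget-lookup L₀ w i)))
    heights : ∀ k → k ≤ m → netHeight (take k (toList w)) + + ∑ k (isDn ∘ s) ≡ + ∑ k (isUn ∘ s)
    heights k k≤m = subst (λ z → netHeight (take k (toList z)) + + ∑ k (isDn ∘ s) ≡ + ∑ k (isUn ∘ s)) (sym w≡tabulate) (netHeight-count m s k k≤m)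
    weights-bounded : ∀ p → p < m → r p ℕ.+ ∑ p (isDn ∘ s) ≤ ∑ p (isUn ∘ s)
    weights-bounded p p<m = ℤ.drop‿+≤+ (subst₂ ℤ._≤_ (sym (ℤ.pos-+ (r p) _)) (heights p (<⇒≤ p<m))
      (ℤ.+-monoˡ-≤ (+ ∑ p (isDn ∘ s)) r≤height))
      where
      i = fromℕ< p<m
      r≤height : + r p ℤ.≤ netHeight (take p (toList w))
      r≤height = subst₂ (λ a b → + a ℤ.≤ netHeight (take b (toList w)))
        (trans (sym (vget-lookup 0 μv i)) (cong r (toℕ-fromℕ< p<m))) (toℕ-fromℕ< p<m) (bd i)
    balanced : ∑ m (isUn ∘ s) ≡ ∑ m (isDn ∘ s)
    balanced = sym (ℤ.+-injective (trans (cong (_+ + ∑ m (isDn ∘ s)) (sym ends-at-0)) (heights m ≤-refl)))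
      where
      ends-at-0 : netHeight (take m (toList w)) ≡ 0ℤ
      ends-at-0 = trans (cong netHeight (take-all m (toList w) (≤-reflexive (length-toList w)))) (proj₂ mot)
    open DecodeHistory m s r weights-bounded balanced
    same-path : Laguerre.path (Φ π) ≡ w
    same-path = trans (tabulate-cong (λ i → trans (code-step (toℕ i) (toℕ<n i)) (vget-lookup L₀ w i))) (tabulate∘lookup w)
    same-weights : Laguerre.weights (Φ π) ≡ μv
    same-weights = trans (tabulate-cong (λ i → trans (code-weight (toℕ i) (toℕ<n i)) (vget-lookup 0 μv i))) (tabulate∘lookup μv)

  Φ-excedances : ∀ m (σ : Permutation′ (suc m)) → (∀ (i : Fin m) → isExc σ (inject₁ i) ≡ isUorL₁ (lookup (Laguerre.path (Φ σ)) i))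
    × isExc σ (fromℕ m) ≡ false
  Φ-excedances m σ = at-steps , at-last
    where
    open Code (toPermN σ)
    at-steps : ∀ (i : Fin m) → isExc σ (inject₁ i) ≡ isUorL₁ (lookup (Laguerre.path (Φ σ)) i)
    at-steps i = sym (trans (cong isUorL₁ (lookup∘tabulate (step ∘ toℕ) i))
      (trans (isUorL₁-mkStep (excᵇ (toℕ i)) (weakᵇ (toℕ i)))
      (trans (cong excᵇ (sym (toℕ-inject₁ i))) (cong (toℕ (inject₁ i) <ᵇ_) (ext-toℕ (σ ⟨$⟩ʳ_) (inject₁ i))))))
    at-last : isExc σ (fromℕ m) ≡ false
    at-last rewrite toℕ-fromℕ m = <ᵇ-false (<⇒≱ (toℕ<n (σ ⟨$⟩ʳ fromℕ m)))

  Φ-inv-exc : ∀ m (σ : Permutation′ (suc m)) → + inv σ - + exc σ ≡ area (Laguerre.path (Φ σ)) + + sumℕ (Laguerre.weights (Φ σ))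
  Φ-inv-exc m σ = begin
      + inv σ - + exc σ                 ≡⟨ cong₂ (λ a b → + a - + b) inv≡ exc≡ ⟩
      + ∑ n (λ a → ∑ n (λ b → [ (a <ᵇ b) ∧ (f b <ᵇ f a) ])) - + E
                                        ≡⟨ cong (λ z → + z - + E) inversion-decomposition ⟩
      + (E ℕ.+ (A ℕ.+ M)) - + E         ≡⟨ cong (_- + E) (trans (ℤ.pos-+ E _) (cong (λ z → + E + z) (ℤ.pos-+ A M))) ⟩
      (+ E + (+ A + + M)) - + E         ≡⟨ cancel (+ E) (+ A) (+ M) ⟩
      + A + + M                         ≡⟨ cong₂ _+_ (sym area≡) (cong +_ (sym weights≡)) ⟩
      area (Laguerre.path (Φ σ)) + + sumℕ (Laguerre.weights (Φ σ)) ∎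
    where
    open ≡-Reasoning
    open PermN (toPermN σ)
    open Code (toPermN σ)
    open CodeOf σ using (height≡cross)
    E = ∑ n ([_] ∘ excᵇ)
    A = ∑ m cross
    M = ∑ m μ
    cancel : ∀ (a b c : ℤ) → (a + (b + c)) - a ≡ b + c
    cancel = solve-∀
    inv≡ : inv σ ≡ ∑ n (λ a → ∑ n (λ b → [ (a <ᵇ b) ∧ (f b <ᵇ f a) ]))
    inv≡ = sum-allFin≡∑ n _ _ (λ i → sum-allFin≡∑ n _ _ (λ j →
      cong₂ (λ x y → [ (toℕ i <ᵇ toℕ j) ∧ (x <ᵇ y) ]) (sym (ext-toℕ (σ ⟨$⟩ʳ_) j)) (sym (ext-toℕ (σ ⟨$⟩ʳ_) i))))
    exc≡ : exc σ ≡ E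
    exc≡ = sum-allFin≡∑ n _ _ (λ i → cong (λ x → [ toℕ i <ᵇ x ]) (sym (ext-toℕ (σ ⟨$⟩ʳ_) i)))
    area≡ : area (Laguerre.path (Φ σ)) ≡ + A
    area≡ = trans (cong (foldr _+_ 0ℤ) (map-tabulate (λ x → x) (height (Laguerre.path (Φ σ)))))
      (foldr-tabulate≡∑ m _ cross (λ i → height≡cross (toℕ i) (<⇒≤ (toℕ<n i))))
    weights≡ : sumℕ (Laguerre.weights (Φ σ)) ≡ M
    weights≡ = sum-toList-tabulate≡∑ m μ


open import Defs
open import Data.Nat using (ℕ; suc)
open import Data.Integer using (+_; _+_; _-_)
open import Data.Fin using (Fin; inject₁; fromℕ)
open import Data.Fin.Permutation using (Permutation′; _⟨$⟩ʳ_)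
open import Data.Vec using (lookup)
open import Data.Bool using (false)
open import Data.Product using (Σ; _×_; _,_)
open import Relation.Binary.PropositionalEquality using (_≡_)
open Bijection using (Φ; Φ-injective; Φ-surjective; Φ-excedances; Φ-inv-exc)

theorem2 : ∀ (m : ℕ) → Σ (Permutation′ (suc m) → Laguerre m) λ Φ →
    (∀ σ τ → Laguerre.path (Φ σ) ≡ Laguerre.path (Φ τ)
    → Laguerre.weights (Φ σ) ≡ Laguerre.weights (Φ τ)
    → ∀ i → σ ⟨$⟩ʳ i ≡ τ ⟨$⟩ʳ i)
    × (∀ (h : Laguerre m) → Σ (Permutation′ (suc m)) λ σ →
    Laguerre.path (Φ σ) ≡ Laguerre.path h × Laguerre.weights (Φ σ) ≡ Laguerre.weights h)
    × (∀ σ → (∀ (i : Fin m) → isExc σ (inject₁ i) ≡ isUorL₁ (lookup (Laguerre.path (Φ σ)) i))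
    × isExc σ (fromℕ m) ≡ false)
    × (∀ σ → + inv σ - + exc σ ≡ area (Laguerre.path (Φ σ)) + + sumℕ (Laguerre.weights (Φ σ)))
theorem2 m = Φ , Φ-injective m , Φ-surjective m , Φ-excedances m , Φ-inv-exc m
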